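{- Let $\mathcal{M}$ be a concurrent game model, $q$ a state, $\varphi$ an ATL-formula, $\Gamma>0$ an ordinal and $\mathbf{P}\in\{\mathbf{A},\mathbf{E}\}$. Then (1) $\mathbf{P}$ has a winning strategy in the unbounded evaluation game $\mathcal{G}(\mathcal{M},q,\varphi)$ iff $\overline{\mathbf{P}}$ does not have a winning strategy in $\mathcal{G}(\mathcal{M},q,\varphi)$; and (2) $\mathbf{P}$ has a winning strategy in the $\Gamma$-bounded evaluation game $\mathcal{G}(\mathcal{M},q,\varphi,\Gamma)$ iff $\overline{\mathbf{P}}$ does not have a winning strategy in $\mathcal{G}(\mathcal{M},q,\varphi,\Gamma)$.
   Context: A concurrent game model (CGM) is $\mathcal{M}=(\mathrm{Agt},\mathrm{St},\Pi,\mathrm{Act},d,o,v)$: $\mathrm{Agt}=\{1,\dots,k\}$ agents; nonempty sets $\mathrm{St}$ (states), $\Pi$ (proposition symbols), $\mathrm{Act}$ (actions); $d:\mathrm{Agt}\times\mathrm{St}\to\mathcal{P}(\mathrm{Act})\setminus\{\emptyset\}$; $o$ assigns to each state $q$ and each action profile $(\alpha_1,\dots,\alpha_k)$ with $\alpha_i\in d(i,q)$ an outcome state; $v:\Pi\to\mathcal{P}(\mathrm{St})$. For $A\subseteq\mathrm{Agt}$, $\overline{A}=\mathrm{Agt}\setminus A$ and $\mathrm{action}(A,q)$ is the set of tuples $(\alpha_i)_{i\in A}$ with $\alpha_i\in d(i,q)$. ATL formulae: $\varphi::=p\mid\neg\varphi\mid(\varphi\vee\varphi)\mid\langle\!\langle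 A\rangle\!\rangle\mathsf{X}\varphi\mid\langle\!\langle A\rangle\!\rangle\varphi\,\mathsf{U}\,\varphi\mid\langle\!\langle A\rangle\!\rangle\varphi\,\mathsf{R}\,\varphi$. Players: Eloise $\mathbf{E}$, Abelard $\mathbf{A}$; $\overline{\mathbf{P}}$ is the opponent of $\mathbf{P}$. One step game $\mathrm{step}(\mathbf{P},A,q)$: $\mathbf{P}$ picks a tuple in $\mathrm{action}(A,q)$, then $\overline{\mathbf{P}}$ picks a tuple in $\mathrm{action}(\overline{A},q)$; the resulting state is the outcome of the combined profile. Unbounded evaluation game $\mathcal{G}(\mathcal{M},q_{in},\varphi)$: positions $(\mathbf{P},q,\psi)$ with $\psi$ a subformula of $\varphi$; start $(\mathbf{E},q_{in},\varphi)$. At $(\mathbf{P},q,p)$ the game ends, $\mathbf{P}$ wins iff $q\in v(p)$, else $\overline{\mathbf{P}}$ wins. $(\mathbf{P},q,\neg\psi)\to(\overline{\mathbf{P}},q,\psi)$. At $(\mathbf{P},q,\psi\vee\theta)$, $\mathbf{P}$ chooses $(\mathbf{P},q,\psi)$ or $(\mathbf{P},q,\theta)$. At $(\mathbf{P},q,\langle\!\langle A\rangle\!\rangle\mathsf{X}\psi)$, $\mathrm{step}(\mathbf{P},A,q)$ gives $q'$, next $(\mathbf{P},q',\psi)$. At $(\mathbf{P},q,\langle\!\langle A\rangle\!\rangle\psi\mathsf{U}\theta)$ the embedded game $\mathbf{g}(\mathbf{P},\mathbf{P},A,q,\theta,\psi)$ is played; at $(\mathbf{P},q,\langle\!\langle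 A\rangle\!\rangle\psi\mathsf{R}\theta)$ the embedded game $\mathbf{g}(\mathbf{P},\overline{\mathbf{P}},A,q,\theta,\psi)$. An embedded game $\mathbf{g}(\mathbf{V},\mathbf{C},A,q_0,\psi_{\mathbf{C}},\psi_{\overline{\mathbf{C}}})$ (verifier $\mathbf{V}$, controller $\mathbf{C}$) proceeds from $q_0$; at current state $q$: (i) $\mathbf{C}$ may end it at exit position $(\mathbf{V},q,\psi_{\mathbf{C}})$; (ii) $\overline{\mathbf{C}}$ may end it at $(\mathbf{V},q,\psi_{\overline{\mathbf{C}}})$; (iii) otherwise $\mathrm{step}(\mathbf{V},A,q)$ gives $q'$ and play continues from $q'$. If it lasts infinitely many rounds, $\mathbf{C}$ loses the evaluation game; otherwise the evaluation game continues from the exit position. $\Gamma$-bounded evaluation game $\mathcal{G}(\mathcal{M},q_{in},\varphi,\Gamma)$: identical except in embedded games: $\mathbf{C}$ first chooses an ordinal $\gamma_0<\Gamma$; play goes through configurations $(\gamma,q)$ from $(\gamma_0,q_0)$ with rules in order: (i) if $\gamma=0$ end at $(\mathbf{V},q,\psi_{\mathbf{C}})$; (ii) $\mathbf{C}$ may end at $(\mathbf{V},q,\psi_{\mathbf{C}})$; (iii) $\overline{\mathbf{C}}$ may end at $(\mathbf{V},q,\psi_{\overline{\mathbf{C}}})$; (iv) otherwise $\mathrm{step}(\mathbf{V},A,q)$ gives $q'$, continue from $(\gamma',q')$ with $\gamma'=\gamma-1$ if $\gamma$ is a successor and $\gamma'<\gamma$ chosen by $\mathbf{C}$ if $\gamma$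 is a limit. Strategies: a player's strategy specifies disjunct choices, tuples of actions (as verifier) or response functions $\mathrm{action}(A,q)\to\mathrm{action}(\overline{A},q)$ (as falsifier) in one step games, and for each until/release position a strategy for the embedded game: in the unbounded game it depends only on the current state (giving, at each state, either "end the game" as permitted by the player's role, or an action tuple / response function); in the $\Gamma$-bounded game the controller picks $\gamma_0<\Gamma$, a timer $t$ (with $t(\gamma,q)<\gamma$ for limit $\gamma$, the new time limit when the limit is $\gamma$ and the new state is $q$) and an embedded strategy depending on configurations $(\gamma,q)$, while the non-controller picks for each $\gamma_0<\Gamma$ an embedded strategy depending on configurations. A winning strategy is one under which the player wins every play consistent with it. -}

module Defs where

open import Data.Nat using (ℕ; zero; suc; _≤_)
open import Data.Fin using (Fin)
open import Data.Bool using (Bool; true; false; not; T; if_then_else_)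
open import Data.Unit using (⊤; tt)
open import Data.Product using (Σ; _×_; _,_)
open import Data.Sum using (_⊎_; inj₁; inj₂)
open import Data.Maybe using (Maybe; just; nothing)
open import Relation.Nullary using (¬_)
open import Relation.Binary.PropositionalEquality using (_≡_)
open import Induction.WellFounded using (WellFounded)

data Player : Set where
  𝐄 𝐀 : Player

opp : Player → Player
opp 𝐄 = 𝐀
opp 𝐀 = 𝐄

_==ᴾ_ : Player → Player → Bool
𝐄 ==ᴾ 𝐄 = true
𝐀 ==ᴾ 𝐀 = true
𝐄 ==ᴾ 𝐀 = false
𝐀 ==ᴾ 𝐄 = false

-- Concurrent game models.  Agt = Fin k; subsets of St / Act are
-- characteristic functions into Bool (so membership proofs are unique).

record CGM : Set₁ where
  field
    k    : ℕ
    St   : Set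
    Π    : Set
    Act  : Set
    st₀  : St
    π₀   : Π
    act₀ : Act
    d    : Fin k → St → Act → Bool
    d-ne : ∀ i q → Σ Act (λ a → T (d i q a))
    o    : (q : St) → ((i : Fin k) → Σ Act (λ a → T (d i q a))) → St
    v    : Π → St → Bool

-- Ordinals Γ: an ordinal is represented by a well-ordered set (its
-- order type); the ordinals γ < Γ are the elements of the carrier.

record WellOrder : Set₁ where
  field
    O     : Set
    _<_   : O → O → Set
    wf    : WellFounded _<_
    trans : ∀ {a b c} → a < b → b < c → a < c
    tri   : ∀ a b → a < b ⊎ (a ≡ b ⊎ b < a)

  IsZero : O → Set
  IsZero γ = ∀ δ → ¬ (δ < γ)

  IsSuccOf : O → O → Set
  IsSuccOf γ δ = δ < γ × (∀ ε → ε < γ → ε < δ ⊎ ε ≡ δ)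

  IsLimit : O → Set
  IsLimit γ = ¬ IsZero γ × (∀ δ → ¬ IsSuccOf γ δ)

data Kind : Set where
  𝐔 𝐑 : Kind

module Eval (M : CGM) where
  open CGM M

  Coalition : Set
  Coalition = Fin k → Bool

  co : Coalition → Coalition
  co A i = not (A i)

  Tup : Coalition → St → Set
  Tup A q = (i : Fin k) → T (A i) → Σ Act (λ a → T (d i q a))

  Profile : St → Set
  Profile q = (i : Fin k) → Σ Act (λ a → T (d i q a))

  join : ∀ {A q} → Tup A q → Tup (co A) q → Profile q
  join {A} α β i with A i | α i | β i
  ... | true  | f | g = f _
  ... | false | f | g = g _

  infixr 6 _∨ᶠ_
  data Fm : Set where
    atom    : Π → Fm
    ¬ᶠ_     : Fm → Fm
    _∨ᶠ_    : Fm → Fm → Fm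
    ⟪_⟫X_   : Coalition → Fm → Fm
    ⟪_⟫_U_  : Coalition → Fm → Fm → Fm
    ⟪_⟫_R_  : Coalition → Fm → Fm → Fm

  -- the until/release position (P, q₀, ⟪A⟫ ψ U/R θ) an embedded game comes from
  record Origin : Set where
    constructor orig
    field
      P  : Player
      q₀ : St
      κ  : Kind
      A  : Coalition
      ψ  : Fm
      θ  : Fm

  -- verifier, controller and the two exit formulae of the embedded game
  -- U: g(P,P,A,q,θ,ψ);  R: g(P,P̄,A,q,θ,ψ)
  Ver : Origin → Player
  Ver w = Origin.P w

  Ctl : Origin → Player
  Ctl (orig P _ 𝐔 _ _ _) = P
  Ctl (orig P _ 𝐑 _ _ _) = opp P

  ψC : Origin → Fm
  ψC w = Origin.θ w

  ψCb : Origin → Fm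
  ψCb w = Origin.ψ w

  -- a move in step(V,A,q): a tuple (as verifier, b = true) or a
  -- response function (as falsifier, b = false)
  SMove : Bool → Coalition → St → Set
  SMove true  A q = Tup A q
  SMove false A q = Tup A q → Tup (co A) q

  atomWinner : Player → St → Π → Player
  atomWinner P q p = if v p q then P else opp P

  module Plays {Pos : Set} (winner : Pos → Maybe Player)
               (ctrl : Pos → Maybe Player) where
    Won : Player → (ℕ → Pos) → Set
    Won X s = Σ ℕ (λ n → winner (s n) ≡ just X)
            ⊎ Σ ℕ (λ N → ∀ m → N ≤ m → ctrl (s m) ≡ just (opp X))

  data UPos : Set where
    main : Player → St → Fm → UPos
    -- one step game, after P chose α
    nx₂  : (P : Player) (q : St) (A : Coalition) (ψ : Fm) → Tup A q → UPos
    -- embedded game at current state q: C may end / C̄ may end / V picks / V̄ responds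
    eC eCb eV : Origin → St → UPos
    eVb  : (w : Origin) (q : St) → Tup (Origin.A w) q → UPos

  data UStep : UPos → UPos → Set where
    s-atom : ∀ {P q p} → UStep (main P q (atom p)) (main P q (atom p))
    s-neg  : ∀ {P q ψ} → UStep (main P q (¬ᶠ ψ)) (main (opp P) q ψ)
    s-orL  : ∀ {P q ψ θ} → UStep (main P q (ψ ∨ᶠ θ)) (main P q ψ)
    s-orR  : ∀ {P q ψ θ} → UStep (main P q (ψ ∨ᶠ θ)) (main P q θ)
    s-nx₁  : ∀ {P q A ψ} (α : Tup A q) → UStep (main P q (⟪ A ⟫X ψ)) (nx₂ P q A ψ α)
    s-nx₂  : ∀ {P q A ψ α} (β : Tup (co A) q) →
             UStep (nx₂ P q A ψ α) (main P (o q (join α β)) ψ)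
    s-U    : ∀ {P q A ψ θ} → UStep (main P q (⟪ A ⟫ ψ U θ)) (eC (orig P q 𝐔 A ψ θ) q)
    s-R    : ∀ {P q A ψ θ} → UStep (main P q (⟪ A ⟫ ψ R θ)) (eC (orig P q 𝐑 A ψ θ) q)
    s-Cend : ∀ {w q} → UStep (eC w q) (main (Ver w) q (ψC w))
    s-Cgo  : ∀ {w q} → UStep (eC w q) (eCb w q)
    s-Cbend : ∀ {w q} → UStep (eCb w q) (main (Ver w) q (ψCb w))
    s-Cbgo : ∀ {w q} → UStep (eCb w q) (eV w q)
    s-V    : ∀ {w q} (α : Tup (Origin.A w) q) → UStep (eV w q) (eVb w q α)
    s-Vb   : ∀ {w q α} (β : Tup (co (Origin.A w)) q) →
             UStep (eVb w q α) (eC w (o q (join α β)))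

  uwinner : UPos → Maybe Player
  uwinner (main P q (atom p)) = just (atomWinner P q p)
  uwinner _ = nothing

  uctrl : UPos → Maybe Player
  uctrl (eC w _)    = just (Ctl w)
  uctrl (eCb w _)   = just (Ctl w)
  uctrl (eV w _)    = just (Ctl w)
  uctrl (eVb w _ _) = just (Ctl w)
  uctrl _ = nothing

  record UStrat (X : Player) : Set where
    field
      -- at (X, q, ψ ∨ θ): true = choose ψ, false = choose θ
      disj : St → Fm → Fm → Bool
      nxt  : (P : Player) (q : St) (A : Coalition) (ψ : Fm) → SMove (P ==ᴾ X) A q
      -- for each until/release position, a strategy for the embedded game
      -- depending only on the current state: inj₁ tt = "end the game"
      emb  : (w : Origin) (q : St) → ⊤ ⊎ SMove (Ver w ==ᴾ X) (Origin.A w) q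

  module _ {X : Player} (σ : UStrat X) where
    open UStrat σ

    private
      endOr : ∀ {B C : Set} → B ⊎ C → UPos → UPos → UPos → Set
      endOr (inj₁ _) e c p' = p' ≡ e
      endOr (inj₂ _) e c p' = p' ≡ c

      fV : ∀ w q (b : Bool) → ⊤ ⊎ SMove b (Origin.A w) q → UPos → Set
      fV w q true (inj₂ α) p' = p' ≡ eVb w q α
      fV w q _ _ p' = ⊤

      fVb : ∀ w q α (b : Bool) → ⊤ ⊎ SMove b (Origin.A w) q → UPos → Set
      fVb w q α false (inj₂ f) p' = p' ≡ eC w (o q (join α (f α)))
      fVb w q α _ _ p' = ⊤

      fN1 : ∀ P q A ψ (b : Bool) → SMove b A q → UPos → Set
      fN1 P q A ψ true α p' = p' ≡ nx₂ P q A ψ α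
      fN1 P q A ψ false _ p' = ⊤

      fN2 : ∀ P q A ψ (α : Tup A q) (b : Bool) → SMove b A q → UPos → Set
      fN2 P q A ψ α false f p' = p' ≡ main P (o q (join α (f α))) ψ
      fN2 P q A ψ α true _ p' = ⊤

    UFollows : UPos → UPos → Set
    UFollows (main P q (ψ ∨ᶠ θ)) p' =
      if P ==ᴾ X then p' ≡ main P q (if disj q ψ θ then ψ else θ) else ⊤
    UFollows (main P q (⟪ A ⟫X ψ)) p' = fN1 P q A ψ (P ==ᴾ X) (nxt P q A ψ) p'
    UFollows (nx₂ P q A ψ α) p' = fN2 P q A ψ α (P ==ᴾ X) (nxt P q A ψ) p'
    UFollows (eC w q) p' =
      if Ctl w ==ᴾ X then endOr (emb w q) (main (Ver w) q (ψC w)) (eCb w q) p' else ⊤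
    UFollows (eCb w q) p' =
      if opp (Ctl w) ==ᴾ X then endOr (emb w q) (main (Ver w) q (ψCb w)) (eV w q) p' else ⊤
    UFollows (eV w q) p' = fV w q (Ver w ==ᴾ X) (emb w q) p'
    UFollows (eVb w q α) p' = fVb w q α (Ver w ==ᴾ X) (emb w q) p'
    UFollows _ _ = ⊤

  open Plays uwinner uctrl renaming (Won to UWon)

  UWins : Player → St → Fm → Set
  UWins X q φ = Σ (UStrat X) λ σ →
    (s : ℕ → UPos) → s 0 ≡ main 𝐄 q φ →
    (∀ n → UStep (s n) (s (suc n)) × UFollows σ (s n) (s (suc n))) →
    UWon X s

  module Bounded (Γ : WellOrder) where
    open WellOrder Γ

    data BPos : Set where
      main : Player → St → Fm → BPos
      nx₂  : (P : Player) (q : St) (A : Coalition) (ψ : Fm) → Tup A q → BPos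
      -- C chooses γ₀
      bStart : Origin → BPos
      -- configurations (γ, q) of the embedded game started with γ₀
      bCfg bC bCb bV bNext bLim : (w : Origin) (γ₀ γ : O) (q : St) → BPos
      bVb : (w : Origin) (γ₀ γ : O) (q : St) → Tup (Origin.A w) q → BPos

    data BStep : BPos → BPos → Set where
      s-atom : ∀ {P q p} → BStep (main P q (atom p)) (main P q (atom p))
      s-neg  : ∀ {P q ψ} → BStep (main P q (¬ᶠ ψ)) (main (opp P) q ψ)
      s-orL  : ∀ {P q ψ θ} → BStep (main P q (ψ ∨ᶠ θ)) (main P q ψ)
      s-orR  : ∀ {P q ψ θ} → BStep (main P q (ψ ∨ᶠ θ)) (main P q θ)
      s-nx₁  : ∀ {P q A ψ} (α : Tup A q) → BStep (main P q (⟪ A ⟫X ψ)) (nx₂ P q A ψ α)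
      s-nx₂  : ∀ {P q A ψ α} (β : Tup (co A) q) →
               BStep (nx₂ P q A ψ α) (main P (o q (join α β)) ψ)
      s-U    : ∀ {P q A ψ θ} → BStep (main P q (⟪ A ⟫ ψ U θ)) (bStart (orig P q 𝐔 A ψ θ))
      s-R    : ∀ {P q A ψ θ} → BStep (main P q (⟪ A ⟫ ψ R θ)) (bStart (orig P q 𝐑 A ψ θ))
      s-start : ∀ {w} (γ₀ : O) → BStep (bStart w) (bCfg w γ₀ γ₀ (Origin.q₀ w))
      s-zero  : ∀ {w γ₀ γ q} → IsZero γ → BStep (bCfg w γ₀ γ q) (main (Ver w) q (ψC w))
      s-nzero : ∀ {w γ₀ γ q} → ¬ IsZero γ → BStep (bCfg w γ₀ γ q) (bC w γ₀ γ q)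
      s-Cend  : ∀ {w γ₀ γ q} → BStep (bC w γ₀ γ q) (main (Ver w) q (ψC w))
      s-Cgo   : ∀ {w γ₀ γ q} → BStep (bC w γ₀ γ q) (bCb w γ₀ γ q)
      s-Cbend : ∀ {w γ₀ γ q} → BStep (bCb w γ₀ γ q) (main (Ver w) q (ψCb w))
      s-Cbgo  : ∀ {w γ₀ γ q} → BStep (bCb w γ₀ γ q) (bV w γ₀ γ q)
      s-V     : ∀ {w γ₀ γ q} (α : Tup (Origin.A w) q) → BStep (bV w γ₀ γ q) (bVb w γ₀ γ q α)
      s-Vb    : ∀ {w γ₀ γ q α} (β : Tup (co (Origin.A w)) q) →
                BStep (bVb w γ₀ γ q α) (bNext w γ₀ γ (o q (join α β)))
      s-succ  : ∀ {w γ₀ γ q δ} → IsSuccOf γ δ → BStep (bNext w γ₀ γ q) (bCfg w γ₀ δ q)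
      s-lim   : ∀ {w γ₀ γ q} → IsLimit γ → BStep (bNext w γ₀ γ q) (bLim w γ₀ γ q)
      s-limpick : ∀ {w γ₀ γ q} (γ' : O) → γ' < γ → BStep (bLim w γ₀ γ q) (bCfg w γ₀ γ' q)

    bwinner : BPos → Maybe Player
    bwinner (main P q (atom p)) = just (atomWinner P q p)
    bwinner _ = nothing

    bctrl : BPos → Maybe Player
    bctrl (main _ _ _) = nothing
    bctrl (nx₂ _ _ _ _ _) = nothing
    bctrl (bStart w) = just (Ctl w)
    bctrl (bCfg w _ _ _) = just (Ctl w)
    bctrl (bC w _ _ _) = just (Ctl w)
    bctrl (bCb w _ _ _) = just (Ctl w)
    bctrl (bV w _ _ _) = just (Ctl w)
    bctrl (bNext w _ _ _) = just (Ctl w)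
    bctrl (bLim w _ _ _) = just (Ctl w)
    bctrl (bVb w _ _ _ _) = just (Ctl w)

    record CtrlS (X : Player) (w : Origin) : Set where
      field
        γ₀     : O
        timer  : O → St → O
        timer< : ∀ γ q → IsLimit γ → timer γ q < γ
        mv     : (γ : O) (q : St) → ⊤ ⊎ SMove (Ver w ==ᴾ X) (Origin.A w) q

    NonCtrlS : Player → Origin → Set
    NonCtrlS X w = (γ₀ : O) (γ : O) (q : St) → ⊤ ⊎ SMove (Ver w ==ᴾ X) (Origin.A w) q

    record BStrat (X : Player) : Set where
      field
        disj : St → Fm → Fm → Bool
        nxt  : (P : Player) (q : St) (A : Coalition) (ψ : Fm) → SMove (P ==ᴾ X) A q
        emb  : (w : Origin) → if Ctl w ==ᴾ X then CtrlS X w else NonCtrlS X w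

    embMove : ∀ {X} w (b : Bool) → (if b then CtrlS X w else NonCtrlS X w) →
              (γ₀ γ : O) (q : St) → ⊤ ⊎ SMove (Ver w ==ᴾ X) (Origin.A w) q
    embMove w true  c γ₀ = CtrlS.mv c
    embMove w false f    = f

    module _ {X : Player} (σ : BStrat X) where
      open BStrat σ

      private
        mvAt : ∀ w (γ₀ γ : O) (q : St) → ⊤ ⊎ SMove (Ver w ==ᴾ X) (Origin.A w) q
        mvAt w = embMove w (Ctl w ==ᴾ X) (emb w)

        endOr : ∀ {B C : Set} → B ⊎ C → BPos → BPos → BPos → Set
        endOr (inj₁ _) e c p' = p' ≡ e
        endOr (inj₂ _) e c p' = p' ≡ c

        fV : ∀ w γ₀ γ q (b : Bool) → ⊤ ⊎ SMove b (Origin.A w) q → BPos → Set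
        fV w γ₀ γ q true (inj₂ α) p' = p' ≡ bVb w γ₀ γ q α
        fV w γ₀ γ q _ _ p' = ⊤

        fVb : ∀ w γ₀ γ q α (b : Bool) → ⊤ ⊎ SMove b (Origin.A w) q → BPos → Set
        fVb w γ₀ γ q α false (inj₂ f) p' = p' ≡ bNext w γ₀ γ (o q (join α (f α)))
        fVb w γ₀ γ q α _ _ p' = ⊤

        fN1 : ∀ P q A ψ (b : Bool) → SMove b A q → BPos → Set
        fN1 P q A ψ true α p' = p' ≡ nx₂ P q A ψ α
        fN1 P q A ψ false _ p' = ⊤

        fN2 : ∀ P q A ψ (α : Tup A q) (b : Bool) → SMove b A q → BPos → Set
        fN2 P q A ψ α false f p' = p' ≡ main P (o q (join α (f α))) ψ
        fN2 P q A ψ α true _ p' = ⊤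

        fStart : ∀ w (b : Bool) → (if b then CtrlS X w else NonCtrlS X w) → BPos → Set
        fStart w true c p' = p' ≡ bCfg w (CtrlS.γ₀ c) (CtrlS.γ₀ c) (Origin.q₀ w)
        fStart w false _ p' = ⊤

        fLim : ∀ w γ₀ γ q (b : Bool) → (if b then CtrlS X w else NonCtrlS X w) → BPos → Set
        fLim w γ₀ γ q true c p' = p' ≡ bCfg w γ₀ (CtrlS.timer c γ q) q
        fLim w γ₀ γ q false _ p' = ⊤

      BFollows : BPos → BPos → Set
      BFollows (main P q (ψ ∨ᶠ θ)) p' =
        if P ==ᴾ X then p' ≡ main P q (if disj q ψ θ then ψ else θ) else ⊤
      BFollows (main P q (⟪ A ⟫X ψ)) p' = fN1 P q A ψ (P ==ᴾ X) (nxt P q A ψ) p'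
      BFollows (nx₂ P q A ψ α) p' = fN2 P q A ψ α (P ==ᴾ X) (nxt P q A ψ) p'
      BFollows (bStart w) p' = fStart w (Ctl w ==ᴾ X) (emb w) p'
      BFollows (bC w γ₀ γ q) p' =
        if Ctl w ==ᴾ X then endOr (mvAt w γ₀ γ q) (main (Ver w) q (ψC w)) (bCb w γ₀ γ q) p' else ⊤
      BFollows (bCb w γ₀ γ q) p' =
        if opp (Ctl w) ==ᴾ X then endOr (mvAt w γ₀ γ q) (main (Ver w) q (ψCb w)) (bV w γ₀ γ q) p' else ⊤
      BFollows (bV w γ₀ γ q) p' = fV w γ₀ γ q (Ver w ==ᴾ X) (mvAt w γ₀ γ q) p'
      BFollows (bVb w γ₀ γ q α) p' = fVb w γ₀ γ q α (Ver w ==ᴾ X) (mvAt w γ₀ γ q) p'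
      BFollows (bLim w γ₀ γ q) p' = fLim w γ₀ γ q (Ctl w ==ᴾ X) (emb w) p'
      BFollows _ _ = ⊤

    open Plays bwinner bctrl renaming (Won to BWon)

    BWins : Player → St → Fm → Set
    BWins X q φ = Σ (BStrat X) λ σ →
      (s : ℕ → BPos) → s 0 ≡ main 𝐄 q φ →
      (∀ n → BStep (s n) (s (suc n)) × BFollows σ (s n) (s (suc n))) →
      BWon X s

-- Classically every position of the evaluation game has a value, the player who wins it: for atoms,
-- negation, disjunction and ⟪A⟫X it is computed as in the semantics of ATL, and at an until/release
-- position it is the controller of the embedded game if he can force (in the attractor sense) an
-- exit of his own value while the other exit, wherever he leaves it open, is also his; otherwise
-- it is his opponent. The player X holding the value of the initial position wins by keeping every
-- position of value X: as controller he follows an attractor witness, as non-controller he avoids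
-- the opponent's attractor. A size measure on formulas shows that a play which never reaches an
-- atom is eventually confined to a single embedded game; in the Γ-bounded game the time limit
-- rules this out, and in the unbounded one it can only happen in a game X does not control, since
-- following witnesses of least rank makes the rank decrease. Conversely, winning strategies for
-- both players would produce a single play won by both.

module Submission where

open import Defs
open import Axiom.ExcludedMiddle using (ExcludedMiddle)
open import Data.Bool using (Bool; true; false; not; if_then_else_)
open import Data.Empty using (⊥; ⊥-elim)
open import Data.Maybe using (Maybe; just; nothing)
open import Data.Maybe.Properties using (just-injective)
open import Data.Nat using (ℕ; zero; suc; _+_; _*_; _∸_; _≤_; _<_; s≤s)
open import Data.Nat.Induction using (<-wellFounded)
open import Data.Nat.Properties
open import Data.Product using (Σ; ∃-syntax; _×_; _,_; proj₁; proj₂)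
open import Data.Product.Relation.Binary.Lex.Strict using (×-wellFounded)
open import Data.Sum using (_⊎_; inj₁; inj₂)
open import Data.Unit using (⊤; tt)
open import Function using (_∘_)
open import Function.Bundles using (_⇔_; mk⇔)
open import Function.Definitions using (Injective)
open import Induction.InfiniteDescent using (InfiniteDescendingSequence; descent∧wf⇒empty)
open import Induction.WellFounded using (Acc; acc; WellFounded)
open import Level using (Level)
open import Relation.Binary.Core using (Rel)
open import Relation.Binary.PropositionalEquality
open import Relation.Nullary using (¬_; Dec; yes; no; does)
open import Relation.Nullary.Decidable using (decidable-stable)

private
  variable
    a r : Level

opp-involutive : ∀ X → opp (opp X) ≡ X
opp-involutive 𝐄 = refl
opp-involutive 𝐀 = refl

opp-≢ : ∀ X → opp X ≢ X
opp-≢ 𝐄 ()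
opp-≢ 𝐀 ()

player-cases : ∀ X Y → Y ≡ X ⊎ Y ≡ opp X
player-cases 𝐄 𝐄 = inj₁ refl
player-cases 𝐄 𝐀 = inj₂ refl
player-cases 𝐀 𝐄 = inj₂ refl
player-cases 𝐀 𝐀 = inj₁ refl

≢⇒≡opp : ∀ {X Y} → Y ≢ X → Y ≡ opp X
≢⇒≡opp {X} {Y} Y≢X with player-cases X Y
... | inj₁ Y≡X = ⊥-elim (Y≢X Y≡X)
... | inj₂ Y≡X̄ = Y≡X̄

≢opp⇒≡ : ∀ {X Y} → Y ≢ opp X → Y ≡ X
≢opp⇒≡ {X} {Y} Y≢X̄ with player-cases X Y
... | inj₁ Y≡X = Y≡X
... | inj₂ Y≡X̄ = ⊥-elim (Y≢X̄ Y≡X̄)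

≡⇒≢opp : ∀ {X Y} → Y ≡ X → Y ≢ opp X
≡⇒≢opp {X} refl e = opp-≢ X (sym e)

≡opp⇒≢ : ∀ {X Y} → Y ≡ opp X → Y ≢ X
≡opp⇒≢ {X} Y≡X̄ Y≡X = opp-≢ X (trans (sym Y≡X̄) Y≡X)

==ᴾ-true : ∀ {P X} → P ≡ X → (P ==ᴾ X) ≡ true
==ᴾ-true {𝐄} refl = refl
==ᴾ-true {𝐀} refl = refl

==ᴾ-false : ∀ {P X} → P ≡ opp X → (P ==ᴾ X) ≡ false
==ᴾ-false {X = 𝐄} refl = refl
==ᴾ-false {X = 𝐀} refl = refl

==ᴾ-opp : ∀ P X → (P ==ᴾ opp X) ≡ not (P ==ᴾ X)
==ᴾ-opp 𝐄 𝐄 = refl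
==ᴾ-opp 𝐄 𝐀 = refl
==ᴾ-opp 𝐀 𝐄 = refl
==ᴾ-opp 𝐀 𝐀 = refl

determined-by : ∀ {ℓ} {Wins : Player → Set ℓ} (winner : Player) →
                (∀ X → winner ≡ X → Wins X) → (∀ X → Wins X → ¬ Wins (opp X)) →
                ∀ P → Wins P ⇔ (¬ Wins (opp P))
determined-by {Wins = Wins} winner wins exclusive P = mk⇔ (exclusive P) from-opponent-losing
  where
    from-opponent-losing : ¬ Wins (opp P) → Wins P
    from-opponent-losing ¬opp-wins with player-cases P winner
    ... | inj₁ winner≡P = wins P winner≡P
    ... | inj₂ winner≡P̄ = ⊥-elim (¬opp-wins (wins (opp P) winner≡P̄))

if-holds : ∀ {ℓ} {b} {A B : Set ℓ} → b ≡ true → (if b then A else B) → A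
if-holds refl a = a

claim : ∀ {ℓ} → Player → {S : Set ℓ} → Dec S → Player
claim P S? = if does S? then P else opp P

claim-inv : ∀ {ℓ} {S : Set ℓ} (S? : Dec S) P X → claim P S? ≡ X →
            (S × P ≡ X) ⊎ (¬ S × opp P ≡ X)
claim-inv (yes s) P X e = inj₁ (s , e)
claim-inv (no ¬s) P X e = inj₂ (¬s , e)

antitone-bounded : (f : ℕ → ℕ) → (∀ n → f (suc n) ≤ f n) → ∀ n k → f (n + k) ≤ f n
antitone-bounded f f↓ n zero = ≤-reflexive (cong f (+-identityʳ n))
antitone-bounded f f↓ n (suc k) =
  ≤-trans (≤-reflexive (cong f (+-suc n k))) (≤-trans (f↓ (n + k)) (antitone-bounded f f↓ n k))

module Classical (lem : ∀ {ℓ} → ExcludedMiddle ℓ) where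

  dec : ∀ {ℓ} (S : Set ℓ) → Dec S
  dec S = lem

  dne : ∀ {ℓ} {S : Set ℓ} → ¬ ¬ S → S
  dne = decidable-stable lem

  choose : {A : Set} (Q : A → Set) → A → A
  choose Q default with dec (Σ _ Q)
  ... | yes (x , _) = x
  ... | no _ = default

  choose-spec : {A : Set} (Q : A → Set) (default : A) → Σ A Q → Q (choose Q default)
  choose-spec Q default ∃Q with dec (Σ _ Q)
  ... | yes (_ , qx) = qx
  ... | no ∄Q = ⊥-elim (∄Q ∃Q)

  choose-cases : {A : Set} (Q : A → Set) (default : A) →
                 Q (choose Q default) ⊎ choose Q default ≡ default
  choose-cases Q default with dec (Σ _ Q)
  ... | yes (_ , qx) = inj₁ qx
  ... | no _ = inj₂ refl

  antitone-eventually-constant : (f : ℕ → ℕ) → (∀ n → f (suc n) ≤ f n) →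
                                 ∃[ N ] ∀ k → f (N + k) ≡ f N
  antitone-eventually-constant f f↓ = go 0 (<-wellFounded (f 0))
    where
      go : ∀ n → Acc _<_ (f n) → ∃[ N ] ∀ k → f (N + k) ≡ f N
      go n (acc rs) with dec (∃[ k ] f (n + k) < f n)
      ... | yes (k , drop) = go (n + k) (rs drop)
      ... | no no-drop =
        n , λ k → ≤-antisym (antitone-bounded f f↓ n k) (≮⇒≥ λ drop → no-drop (k , drop))

no-infinite-descent : {A : Set a} {_<_ : Rel A r} → WellFounded _<_ →
                      (f : ℕ → A) → ¬ InfiniteDescendingSequence _<_ f
no-infinite-descent {_<_ = _<_} wf f f↓ =
  descent∧wf⇒empty {P = λ x → ∃[ n ] f n ≡ x} descends wf (f 0) (0 , refl)
  where
    descends : ∀ {x} → ∃[ n ] f n ≡ x → ∃[ y ] y < x × ∃[ m ] f m ≡ y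
    descends (n , refl) = f (suc n) , f↓ n , suc n , refl

no-lex-descent : {A : Set a} {_⊏_ : Rel A r} → WellFounded _⊏_ → (f : ℕ → A) (g : ℕ → ℕ) →
                 ¬ (∀ n → f (suc n) ⊏ f n ⊎ (f (suc n) ≡ f n × g (suc n) < g n))
no-lex-descent wf f g =
  no-infinite-descent (×-wellFounded wf <-wellFounded) (λ n → f n , g n)

data Ord : Set₁ where
  sup : (I : Set) → (I → Ord) → Ord

_≼_ : Ord → Ord → Set
_≺_ : Ord → Ord → Set
sup I f ≼ y = ∀ i → f i ≺ y
x ≺ sup J g = ∃[ j ] x ≼ g j

≼-refl : ∀ x → x ≼ x
≼-refl (sup I f) i = i , ≼-refl (f i)

mutual
  ≼-trans : ∀ {x y z} → x ≼ y → y ≼ z → x ≼ z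
  ≼-trans {sup I f} x≼y y≼z i = ≺-≼-trans (x≼y i) y≼z

  ≺-≼-trans : ∀ {x y z} → x ≺ y → y ≼ z → x ≺ z
  ≺-≼-trans {y = sup J g} (j , x≼gj) y≼z = ≼-≺-trans x≼gj (y≼z j)

  ≼-≺-trans : ∀ {x y z} → x ≼ y → y ≺ z → x ≺ z
  ≼-≺-trans {z = sup K h} x≼y (k , y≼hk) = k , ≼-trans x≼y y≼hk

≺-wellFounded : WellFounded _≺_
≺-wellFounded x = acc (below x)
  where
    below : ∀ x {y} → y ≺ x → Acc _≺_ y
    below (sup J g) (j , y≼gj) = acc λ z≺y → below (g j) (≺-≼-trans z≺y y≼gj)

module OrdClassical (lem : ∀ {ℓ} → ExcludedMiddle ℓ) where
  open Classical lem

  mutual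
    ≼-or-≻ : ∀ x y → x ≼ y ⊎ y ≺ x
    ≼-or-≻ (sup I f) y with dec (∃[ i ] y ≼ f i)
    ... | yes y≺x = inj₂ y≺x
    ... | no y⊀x = inj₁ λ i → case-i i (≺-or-≽ (f i) y)
      where
        case-i : ∀ i → f i ≺ y ⊎ y ≼ f i → f i ≺ y
        case-i i (inj₁ fi≺y) = fi≺y
        case-i i (inj₂ y≼fi) = ⊥-elim (y⊀x (i , y≼fi))

    ≺-or-≽ : ∀ x y → x ≺ y ⊎ y ≼ x
    ≺-or-≽ x (sup J g) with dec (∃[ j ] x ≼ g j)
    ... | yes x≺y = inj₁ x≺y
    ... | no x⊀y = inj₂ λ j → case-j j (≼-or-≻ x (g j))
      where
        case-j : ∀ j → x ≼ g j ⊎ g j ≺ x → g j ≺ x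
        case-j j (inj₁ x≼gj) = ⊥-elim (x⊀y (j , x≼gj))
        case-j j (inj₂ gj≺x) = gj≺x

  ⊀⇒≽ : ∀ {x y} → ¬ x ≺ y → y ≼ x
  ⊀⇒≽ {x} {y} x⊀y with ≺-or-≽ x y
  ... | inj₁ x≺y = ⊥-elim (x⊀y x≺y)
  ... | inj₂ y≼x = y≼x

module PlayProperties (M : CGM) {Pos : Set} (Step : Pos → Pos → Set)
                      (winner ctrl : Pos → Maybe Player) where
  open Eval.Plays M winner ctrl public

  IsPlay : (ℕ → Pos) → Set
  IsPlay s = ∀ n → Step (s n) (s (suc n))

  suffix : ∀ {R : Pos → Pos → Set} {s : ℕ → Pos} → (∀ n → R (s n) (s (suc n))) →
           ∀ N k → R (s (N + k)) (s (N + suc k))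
  suffix {R} {s} along N k = subst (λ m → R (s (N + k)) (s m)) (sym (+-suc N k)) (along (N + k))

  Terminal : Pos → Set
  Terminal p = ∃[ Y ] winner p ≡ just Y

  module Exclusive (terminal-absorbing : ∀ {p p'} → Terminal p → Step p p' → p' ≡ p)
                   (terminal-uncontrolled : ∀ {p} → Terminal p → ctrl p ≡ nothing) where

    stays-terminal : ∀ {s} → IsPlay s → ∀ n → Terminal (s n) → ∀ k → s (n + k) ≡ s n
    stays-terminal {s} play n t zero = cong s (+-identityʳ n)
    stays-terminal {s} play n t (suc k) =
      trans (cong s (+-suc n k))
        (trans (terminal-absorbing (subst Terminal (sym previous) t) (play (n + k))) previous)
      where previous = stays-terminal play n t k

    terminal-not-trapped : ∀ {s} → IsPlay s → ∀ n → Terminal (s n) →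
                           ∀ N {Y} → ¬ (∀ m → N ≤ m → ctrl (s m) ≡ just Y)
    terminal-not-trapped play n t N trapped
      with trans (sym (trapped (n + N) (m≤n+m N n)))
                 (subst (λ p → ctrl p ≡ nothing) (sym (stays-terminal play n t N))
                        (terminal-uncontrolled t))
    ... | ()

    won-exclusive : ∀ {s} X → IsPlay s → Won X s → Won (opp X) s → ⊥
    won-exclusive {s} X play (inj₁ (n , wins)) (inj₁ (m , loses)) =
      opp-≢ X (just-injective (trans (sym loses) (trans (cong winner same) wins)))
      where
        same : s m ≡ s n
        same = trans (sym (stays-terminal play m (_ , loses) n))
                 (trans (cong s (+-comm m n)) (stays-terminal play n (_ , wins) m))
    won-exclusive X play (inj₁ (n , wins)) (inj₂ (N , trapped)) =
      terminal-not-trapped play n (_ , wins) N trapped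
    won-exclusive X play (inj₂ (N , trapped)) (inj₁ (n , loses)) =
      terminal-not-trapped play n (_ , loses) N trapped
    won-exclusive X play (inj₂ (N , trapped)) (inj₂ (N' , trapped')) =
      opp-≢ (opp X) (just-injective (trans (sym (trapped' (N + N') (m≤n+m N' N)))
                                           (trapped (N + N') (m≤m+n N N'))))

  module Confinement (lem : ∀ {ℓ} → ExcludedMiddle ℓ) {G : Set} (game : Pos → Maybe G) (μ : Pos → ℕ)
    (μ-step : ∀ {p p'} → Step p p' →
              μ p' < μ p ⊎
              (μ p' ≡ μ p × (Terminal p ⊎ ∃[ g ] game p ≡ just g × game p' ≡ just g))) where
    open Classical lem

    μ-antitone : ∀ {p p'} → Step p p' → μ p' ≤ μ p
    μ-antitone st with μ-step st
    ... | inj₁ μ↓ = <⇒≤ μ↓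
    ... | inj₂ (μ≡ , _) = ≤-reflexive μ≡

    eventually-in-one-game : ∀ {s} → IsPlay s → (∀ n → ¬ Terminal (s n)) →
                             ∃[ N ] ∃[ g ] ∀ k → game (s (N + k)) ≡ just g
    eventually-in-one-game {s} play non-terminal = N , g₀ , inside
      where
        constant = antitone-eventually-constant (λ n → μ (s n)) (λ n → μ-antitone (play n))
        N = proj₁ constant
        same-game : ∀ k → ∃[ g ] game (s (N + k)) ≡ just g × game (s (suc (N + k))) ≡ just g
        same-game k with μ-step (play (N + k))
        ... | inj₁ μ↓ = ⊥-elim (<-irrefl (trans (proj₂ constant (suc k)) (sym (proj₂ constant k)))
                                         (subst (λ m → μ (s m) < μ (s (N + k))) (sym (+-suc N k)) μ↓))
        ... | inj₂ (_ , inj₁ t) = ⊥-elim (non-terminal (N + k) t)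
        ... | inj₂ (_ , inj₂ same) = same
        g₀ = proj₁ (same-game 0)
        inside : ∀ k → game (s (N + k)) ≡ just g₀
        inside zero = proj₁ (proj₂ (same-game 0))
        inside (suc k) with same-game k
        ... | g , here , there =
          subst (λ m → game (s m) ≡ just g₀) (sym (+-suc N k))
                (trans there (cong just (just-injective (trans (sym here) (inside k)))))

suc-2*<2*suc : ∀ n → suc (2 * n) < 2 * suc n
suc-2*<2*suc n rewrite *-suc 2 n = n<1+n (suc (2 * n))

module Moves (M : CGM) where
  open CGM M
  open Eval M

  default-tuple : ∀ A q → Tup A q
  default-tuple A q i _ = d-ne i q

  Response : Bool → Coalition → St → Set
  Response true  A q = Tup (co A) q
  Response false A q = Tup A q

  outcome : ∀ b A q → SMove b A q → Response b A q → St
  outcome true  A q α β = o q (join α β)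
  outcome false A q f α = o q (join α (f α))

  default-move : ∀ b A q → SMove b A q
  default-move true  A q = default-tuple A q
  default-move false A q = λ _ → default-tuple (co A) q

  ForcesNext : Bool → Coalition → St → (St → Set) → Set
  ForcesNext b A q G = Σ (SMove b A q) λ m → ∀ r → G (outcome b A q m r)

  ForcesNext-map : ∀ {b A q} {G H : St → Set} → (∀ {q'} → G q' → H q') →
                   ForcesNext b A q G → ForcesNext b A q H
  ForcesNext-map G⇒H (m , forced) = m , λ r → G⇒H (forced r)

  Commits : ∀ b {A q} → SMove b A q → Tup A q → Set
  Commits true  m α = α ≡ m
  Commits false _ _ = ⊤

  Reaches : ∀ b {A q} → SMove b A q → St → Set
  Reaches b {A} {q} m q' = ∃[ r ] outcome b A q m r ≡ q'

  -- the player on side b (verifier iff b) can force the embedded game from q to stop in Exit,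
  -- moving on only from states in Stay
  data Attractor (b : Bool) (A : Coalition) (Exit Stay : St → Set) : St → Set where
    exit : ∀ {q} → Exit q → Attractor b A Exit Stay q
    step : ∀ {q} → Stay q → (m : SMove b A q) →
           (∀ r → Attractor b A Exit Stay (outcome b A q m r)) → Attractor b A Exit Stay q

  -- public counterparts of the private conditions in UFollows and BFollows saying that a move of an
  -- embedded game, a tuple, or a response follows the given choice
  Ends : {Pos B : Set} → ⊤ ⊎ B → Pos → Pos → Pos → Set
  Ends (inj₁ _) stop go p' = p' ≡ stop
  Ends (inj₂ _) stop go p' = p' ≡ go

  PlaysTuple : {Pos : Set} (b : Bool) {A : Coalition} {q : St} →
               ⊤ ⊎ SMove b A q → (Tup A q → Pos) → Pos → Set
  PlaysTuple true (inj₂ α) next p' = p' ≡ next α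
  PlaysTuple _ _ _ _ = ⊤

  Responds : {Pos : Set} (b : Bool) {A : Coalition} {q : St} →
             ⊤ ⊎ SMove b A q → Tup A q → (Tup (co A) q → Pos) → Pos → Set
  Responds false (inj₂ f) α next p' = p' ≡ next (f α)
  Responds _ _ _ _ _ = ⊤

  commits-first : ∀ b {A q} {m : SMove b A q} {Pos : Set} {next : Tup A q → Pos} →
                  Injective _≡_ _≡_ next →
                  ∀ {α} → PlaysTuple b (inj₂ m) next (next α) → Commits b m α
  commits-first true next-injective e = next-injective e
  commits-first false _ _ = tt

  commits-second : ∀ b {A q} {m : SMove b A q} {Pos : Set} {next : St → Pos} →
                   Injective _≡_ _≡_ next →
                   ∀ {α β} → Commits b m α →
                   Responds b (inj₂ m) α (λ β → next (o q (join α β))) (next (o q (join α β))) →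
                   Reaches b m (o q (join α β))
  commits-second true _ {β = β} refl _ = β , refl
  commits-second false next-injective {α} _ e = α , sym (next-injective e)

  module _ {b : Bool} {A : Coalition} {Exit Stay : St → Set} where
    private
      Att = Attractor b A Exit Stay

    node : ∀ {q} → Att q → ⊤ ⊎ SMove b A q
    node (exit _) = inj₁ tt
    node (step _ m _) = inj₂ m

    IsStep : ∀ {q} → Att q → Set
    IsStep (exit _) = ⊥
    IsStep (step _ _ _) = ⊤

    step-stays : ∀ {q} (t : Att q) → IsStep t → Stay q
    step-stays (step stay _ _) _ = stay

    node-ends : ∀ {Pos : Set} {q} (t : Att q) {stop go p' : Pos} →
                Ends (node t) stop go p' → (p' ≡ stop × Exit q) ⊎ (p' ≡ go × IsStep t)
    node-ends (exit ex) e = inj₁ (e , ex)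
    node-ends (step _ _ _) e = inj₂ (e , tt)

    StepsTo : ∀ {q} → Att q → St → Set
    StepsTo (exit _) q' = ⊥
    StepsTo (step _ m _) q' = Reaches b m q'

    subtree : ∀ {q q'} (t : Att q) → StepsTo t q' → Att q'
    subtree (step _ _ k) (r , refl) = k r

    CommitsTo : ∀ {q} → Att q → Tup A q → Set
    CommitsTo (exit _) α = ⊥
    CommitsTo (step _ m _) α = Commits b m α

    node-commits : ∀ {q} {Pos : Set} {next : Tup A q → Pos} → Injective _≡_ _≡_ next →
                   (t : Att q) → IsStep t → ∀ {α} → PlaysTuple b (node t) next (next α) → CommitsTo t α
    node-commits next-injective (step _ _ _) _ = commits-first b next-injective

    node-reaches : ∀ {q} {Pos : Set} {next : St → Pos} → Injective _≡_ _≡_ next →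
                   (t : Att q) → ∀ {α β} → CommitsTo t α →
                   Responds b (node t) α (λ β → next (o q (join α β))) (next (o q (join α β))) →
                   StepsTo t (o q (join α β))
    node-reaches next-injective (step _ _ _) = commits-second b next-injective

  size : Fm → ℕ
  size (atom _) = 0
  size (¬ᶠ ψ) = suc (size ψ)
  size (ψ ∨ᶠ θ) = suc (size ψ + size θ)
  size (⟪ A ⟫X ψ) = suc (size ψ)
  size (⟪ A ⟫ ψ U θ) = suc (size ψ + size θ)
  size (⟪ A ⟫ ψ R θ) = suc (size ψ + size θ)

  game-size : Origin → ℕ
  game-size w = suc (2 * (size (Origin.ψ w) + size (Origin.θ w)))

  exit-C-smaller : ∀ w → 2 * size (Origin.θ w) < game-size w
  exit-C-smaller w = s≤s (*-monoʳ-≤ 2 (m≤n+m (size (Origin.θ w)) (size (Origin.ψ w))))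

  exit-C̅-smaller : ∀ w → 2 * size (Origin.ψ w) < game-size w
  exit-C̅-smaller w = s≤s (*-monoʳ-≤ 2 (m≤m+n (size (Origin.ψ w)) (size (Origin.θ w))))

module ClassicalMoves (lem : ∀ {ℓ} → ExcludedMiddle ℓ) (M : CGM) where
  open CGM M
  open Eval M
  open Classical lem
  open Moves M

  force : ∀ b A q → (St → Set) → SMove b A q
  force b A q G = choose (λ m → ∀ r → G (outcome b A q m r)) (default-move b A q)

  force-spec : ∀ {b A q G} → ForcesNext b A q G → ∀ r → G (outcome b A q (force b A q G) r)
  force-spec {b} {A} {q} = choose-spec _ (default-move b A q)

  step-determined : ∀ b {A q G} → ¬ ForcesNext (not b) A q G → ForcesNext b A q (λ q' → ¬ G q')
  step-determined true {A} {q} {G} ¬force =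
    dne λ ¬avoid → ¬force (respond , λ α → respond-spec α ¬avoid)
    where
      respond : Tup A q → Tup (co A) q
      respond α = choose (λ β → G (o q (join α β))) (default-tuple (co A) q)
      respond-spec : ∀ α → ¬ ForcesNext true A q (λ q' → ¬ G q') → G (o q (join α (respond α)))
      respond-spec α ¬avoid = choose-spec _ _ (dne λ ¬hit → ¬avoid (α , λ β Gq → ¬hit (β , Gq)))
  step-determined false {A} {q} {G} ¬force =
    (λ α → choose (λ β → ¬ G (o q (join α β))) (default-tuple (co A) q)) ,
    λ α → choose-spec _ _ (dne λ ¬escape → ¬force (α , λ β → dne λ ¬Gq → ¬escape (β , ¬Gq)))

  -- after the first half α of the one step game at q, X on side b, playing force b A q G, still reaches G
  Keeps : (b : Bool) (A : Coalition) (q : St) → (St → Set) → Tup A q → Set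
  Keeps true  A q G α = ∀ β → G (o q (join α β))
  Keeps false A q G α = G (o q (join α (force false A q G α)))

  keeps-first : ∀ b {A q G} {Pos : Set} {next : Tup A q → Pos} → Injective _≡_ _≡_ next →
                ForcesNext b A q G → ∀ {α} → PlaysTuple b (inj₂ (force b A q G)) next (next α) →
                Keeps b A q G α
  keeps-first true {A} {q} {G} next-injective F e =
    subst (λ α → ∀ β → G (o q (join α β))) (sym (next-injective e))
          (force-spec {true} {A} {q} {G} F)
  keeps-first false {A} {q} {G} _ F _ = force-spec {false} {A} {q} {G} F _

  keeps-second : ∀ b {A q G} {Pos : Set} {next : St → Pos} → Injective _≡_ _≡_ next →
                 ∀ {α β} → Keeps b A q G α →
                 Responds b (inj₂ (force b A q G)) α (λ β → next (o q (join α β))) (next (o q (join α β))) →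
                 G (o q (join α β))
  keeps-second true _ {β = β} keeps _ = keeps β
  keeps-second false {G = G} next-injective keeps e = subst G (sym (next-injective e)) keeps

  -- Forces w e e̅ : the controller wins the embedded game of w whose exits have values e and e̅
  module Value (Forces : Origin → (St → Player) → (St → Player) → Set) where

    value : Player → St → Fm → Player
    value P q (atom p) = atomWinner P q p
    value P q (¬ᶠ ψ) = value (opp P) q ψ
    value P q (ψ ∨ᶠ θ) = claim P (dec (value P q ψ ≡ P ⊎ value P q θ ≡ P))
    value P q (⟪ A ⟫X ψ) = claim P (dec (ForcesNext true A q λ q' → value P q' ψ ≡ P))
    value P q (⟪ A ⟫ ψ U θ) =
      claim P (dec (Forces (orig P q 𝐔 A ψ θ) (λ q' → value P q' θ) (λ q' → value P q' ψ)))
    value P q (⟪ A ⟫ ψ R θ) =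
      claim (opp P) (dec (Forces (orig P q 𝐑 A ψ θ) (λ q' → value P q' θ) (λ q' → value P q' ψ)))

    exit-value exit-value̅ : Origin → St → Player
    exit-value w q = value (Ver w) q (ψC w)
    exit-value̅ w q = value (Ver w) q (ψCb w)

    value-∨-own : ∀ {X q ψ θ} → value X q (ψ ∨ᶠ θ) ≡ X →
                  value X q (if does (dec (value X q ψ ≡ X)) then ψ else θ) ≡ X
    value-∨-own {X} {q} {ψ} {θ} v with claim-inv (dec (value X q ψ ≡ X ⊎ value X q θ ≡ X)) X X v
    ... | inj₂ (_ , X̄≡X) = ⊥-elim (opp-≢ X X̄≡X)
    ... | inj₁ (one , _) with dec (value X q ψ ≡ X) | one
    ...   | yes left | _ = left
    ...   | no ¬left | inj₁ left = ⊥-elim (¬left left)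
    ...   | no _ | inj₂ right = right

    value-∨-other : ∀ {X q ψ θ} → value (opp X) q (ψ ∨ᶠ θ) ≡ X →
                    value (opp X) q ψ ≡ X × value (opp X) q θ ≡ X
    value-∨-other {X} {q} {ψ} {θ} v
      with claim-inv (dec (value (opp X) q ψ ≡ opp X ⊎ value (opp X) q θ ≡ opp X)) (opp X) X v
    ... | inj₁ (_ , X̄≡X) = ⊥-elim (opp-≢ X X̄≡X)
    ... | inj₂ (neither , _) =
      ≢opp⇒≡ (λ e → neither (inj₁ e)) , ≢opp⇒≡ (λ e → neither (inj₂ e))

    value-next : ∀ {X P q A ψ} → value P q (⟪ A ⟫X ψ) ≡ X →
                 ForcesNext (P ==ᴾ X) A q (λ q' → value P q' ψ ≡ X)
    value-next {X} {P} {q} {A} {ψ} v with player-cases X P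
    ... | inj₁ refl rewrite ==ᴾ-true (refl {x = X})
      with claim-inv (dec (ForcesNext true A q λ q' → value X q' ψ ≡ X)) X X v
    ...   | inj₁ (forced , _) = forced
    ...   | inj₂ (_ , X̄≡X) = ⊥-elim (opp-≢ X X̄≡X)
    value-next {X} {P} {q} {A} {ψ} v | inj₂ refl rewrite ==ᴾ-false (refl {x = opp X})
      with claim-inv (dec (ForcesNext true A q λ q' → value (opp X) q' ψ ≡ opp X)) (opp X) X v
    ...   | inj₁ (_ , X̄≡X) = ⊥-elim (opp-≢ X X̄≡X)
    ...   | inj₂ (¬forced , _) =
          ForcesNext-map {false} {H = λ q' → value (opp X) q' ψ ≡ X} ≢opp⇒≡
            (step-determined false {A} {q} {λ q' → value (opp X) q' ψ ≡ opp X} ¬forced)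

  -- a positional strategy must follow one fixed witness per state; the
  -- witness of least rank makes the ranks decrease along every play
  module Canonical (b : Bool) (A : Coalition) (Exit Stay : St → Set) where
    open OrdClassical lem
    private
      Att = Attractor b A Exit Stay

    rank : ∀ {q} → Att q → Ord
    rank (exit _) = sup ⊥ λ ()
    rank {q} (step _ _ k) = sup (Response b A q) λ r → rank (k r)

    Minimal : ∀ {q} → Att q → Set
    Minimal {q} t = ∀ (t' : Att q) → ¬ rank t' ≺ rank t

    minimal-below : ∀ {q} (t : Att q) → Acc _≺_ (rank t) → Σ (Att q) Minimal
    minimal-below {q} t (acc rs) with dec (Σ (Att q) λ t' → rank t' ≺ rank t)
    ... | yes (t' , smaller) = minimal-below t' (rs smaller)
    ... | no none = t , λ t' smaller → none (t' , smaller)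

    canonical : ∀ {q} → Att q → Att q
    canonical {q} a with dec (Att q)
    ... | yes t = proj₁ (minimal-below t (≺-wellFounded _))
    ... | no ¬t = ⊥-elim (¬t a)

    canonical-irrelevant : ∀ {q} (a a' : Att q) → canonical a ≡ canonical a'
    canonical-irrelevant {q} a a' with dec (Att q)
    ... | yes t = refl
    ... | no ¬t = ⊥-elim (¬t a)

    same-rank : ∀ {q} (a a' : Att q) → rank (canonical a) ≡ rank (canonical a')
    same-rank a a' = cong rank (canonical-irrelevant a a')

    canonical-minimal : ∀ {q} (a : Att q) → Minimal (canonical a)
    canonical-minimal {q} a with dec (Att q)
    ... | yes t = proj₂ (minimal-below t (≺-wellFounded _))
    ... | no ¬t = ⊥-elim (¬t a)

    move : ∀ q → ⊤ ⊎ SMove b A q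
    move q with dec (Att q)
    ... | yes t = node (proj₁ (minimal-below t (≺-wellFounded _)))
    ... | no _ = inj₁ tt

    move-canonical : ∀ {q} (a : Att q) → move q ≡ node (canonical a)
    move-canonical {q} a with dec (Att q)
    ... | yes t = refl
    ... | no ¬t = ⊥-elim (¬t a)

    rank-below : ∀ {q q'} (t : Att q) → StepsTo t q' → (a' : Att q') → rank (canonical a') ≺ rank t
    rank-below (step _ _ k) (r , refl) a' =
      ≼-≺-trans (⊀⇒≽ (canonical-minimal a' (k r))) (r , ≼-refl (rank (k r)))

module UnboundedFollowing (M : CGM) {X : Player} (σ : Eval.UStrat M X) where
  open CGM M
  open Eval M
  open Moves M
  open UStrat σ

  follows-∨ : ∀ {q ψ θ p'} → UFollows σ (main X q (ψ ∨ᶠ θ)) p' →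
              p' ≡ main X q (if disj q ψ θ then ψ else θ)
  follows-∨ = if-holds (==ᴾ-true {X} refl)

  follows-nx₁ : ∀ {P q A ψ p'} → UFollows σ (main P q (⟪ A ⟫X ψ)) p' →
                PlaysTuple (P ==ᴾ X) (inj₂ (nxt P q A ψ)) (nx₂ P q A ψ) p'
  follows-nx₁ {P} {q} {A} {ψ} f with P ==ᴾ X | nxt P q A ψ
  ... | true | _ = f
  ... | false | _ = tt

  follows-nx₂ : ∀ {P q A ψ α p'} → UFollows σ (nx₂ P q A ψ α) p' →
                Responds (P ==ᴾ X) (inj₂ (nxt P q A ψ)) α (λ β → main P (o q (join α β)) ψ) p'
  follows-nx₂ {P} {q} {A} {ψ} f with P ==ᴾ X | nxt P q A ψ
  ... | true | _ = tt
  ... | false | _ = f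

  follows-eC : ∀ {w q m p'} → Ctl w ≡ X → emb w q ≡ m → UFollows σ (eC w q) p' →
               Ends m (main (Ver w) q (ψC w)) (eCb w q) p'
  follows-eC {w} {q} c refl f with Ctl w ==ᴾ X | ==ᴾ-true c
  ... | true | refl with emb w q
  ...   | inj₁ _ = f
  ...   | inj₂ _ = f

  follows-eCb : ∀ {w q m p'} → Ctl w ≡ opp X → emb w q ≡ m → UFollows σ (eCb w q) p' →
                Ends m (main (Ver w) q (ψCb w)) (eV w q) p'
  follows-eCb {w} {q} c refl f with opp (Ctl w) ==ᴾ X | ==ᴾ-true (trans (cong opp c) (opp-involutive X))
  ... | true | refl with emb w q
  ...   | inj₁ _ = f
  ...   | inj₂ _ = f

  follows-eV : ∀ {w q m p'} → emb w q ≡ m → UFollows σ (eV w q) p' →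
               PlaysTuple (Ver w ==ᴾ X) m (eVb w q) p'
  follows-eV {w} {q} refl f with Ver w ==ᴾ X | emb w q
  ... | true | inj₁ _ = tt
  ... | true | inj₂ _ = f
  ... | false | _ = tt

  follows-eVb : ∀ {w q m α p'} → emb w q ≡ m → UFollows σ (eVb w q α) p' →
                Responds (Ver w ==ᴾ X) m α (λ β → eC w (o q (join α β))) p'
  follows-eVb {w} {q} refl f with Ver w ==ᴾ X | emb w q
  ... | false | inj₁ _ = tt
  ... | false | inj₂ _ = f
  ... | true | _ = tt

module UnboundedValue (lem : ∀ {ℓ} → ExcludedMiddle ℓ) (M : CGM) where
  open CGM M
  open Eval M
  open Moves M
  open ClassicalMoves lem M

  ControllerForces : Origin → (St → Player) → (St → Player) → Set
  ControllerForces w e e̅ =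
    Attractor (Ver w ==ᴾ Ctl w) (Origin.A w) (λ q → e q ≡ Ctl w) (λ q → e̅ q ≡ Ctl w) (Origin.q₀ w)

  open Value ControllerForces public

  ForcesFrom : Origin → Player → St → Set
  ForcesFrom w Y =
    Attractor (Ver w ==ᴾ Y) (Origin.A w) (λ q → exit-value w q ≡ Y) (λ q → exit-value̅ w q ≡ Y)

module UnboundedPlays (M : CGM) where
  open CGM M
  open Eval M
  open Moves M

  embedded-game : UPos → Maybe Origin
  embedded-game (eC w _) = just w
  embedded-game (eCb w _) = just w
  embedded-game (eV w _) = just w
  embedded-game (eVb w _ _) = just w
  embedded-game _ = nothing

  open PlayProperties M UStep uwinner uctrl public

  state : UPos → St
  state (main _ q _) = q
  state (nx₂ _ q _ _ _) = q
  state (eC _ q) = q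
  state (eCb _ q) = q
  state (eV _ q) = q
  state (eVb _ q _) = q

  terminal-atom : ∀ {p} → Terminal p → ∃[ P ] ∃[ q ] ∃[ a ] p ≡ main P q (atom a)
  terminal-atom {main P q (atom a)} _ = P , q , a , refl
  terminal-atom {main _ _ (¬ᶠ _)} (_ , ())
  terminal-atom {main _ _ (_ ∨ᶠ _)} (_ , ())
  terminal-atom {main _ _ (⟪ _ ⟫X _)} (_ , ())
  terminal-atom {main _ _ (⟪ _ ⟫ _ U _)} (_ , ())
  terminal-atom {main _ _ (⟪ _ ⟫ _ R _)} (_ , ())
  terminal-atom {nx₂ _ _ _ _ _} (_ , ())
  terminal-atom {eC _ _} (_ , ())
  terminal-atom {eCb _ _} (_ , ())
  terminal-atom {eV _ _} (_ , ())
  terminal-atom {eVb _ _ _} (_ , ())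

  terminal-absorbing : ∀ {p p'} → Terminal p → UStep p p' → p' ≡ p
  terminal-absorbing t st with terminal-atom t
  ... | _ , _ , _ , refl with st
  ...   | s-atom = refl

  terminal-uncontrolled : ∀ {p} → Terminal p → uctrl p ≡ nothing
  terminal-uncontrolled t with terminal-atom t
  ... | _ , _ , _ , refl = refl

  open Exclusive terminal-absorbing terminal-uncontrolled public

  game-controlled : ∀ {p w} → embedded-game p ≡ just w → uctrl p ≡ just (Ctl w)
  game-controlled {eC _ _} refl = refl
  game-controlled {eCb _ _} refl = refl
  game-controlled {eV _ _} refl = refl
  game-controlled {eVb _ _ _} refl = refl

  μ : UPos → ℕ
  μ (main _ _ ψ) = 2 * size ψ
  μ (nx₂ _ _ _ ψ _) = suc (2 * size ψ)
  μ (eC w _) = game-size w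
  μ (eCb w _) = game-size w
  μ (eV w _) = game-size w
  μ (eVb w _ _) = game-size w

  SameGame : UPos → UPos → Set
  SameGame p p' = ∃[ w ] embedded-game p ≡ just w × embedded-game p' ≡ just w

  μ-step : ∀ {p p'} → UStep p p' → μ p' < μ p ⊎ (μ p' ≡ μ p × (Terminal p ⊎ SameGame p p'))
  μ-step s-atom = inj₂ (refl , inj₁ (_ , refl))
  μ-step {main _ _ (¬ᶠ ψ)} s-neg = inj₁ (*-monoʳ-< 2 (n<1+n (size ψ)))
  μ-step {main _ _ (ψ ∨ᶠ θ)} s-orL = inj₁ (*-monoʳ-< 2 (s≤s (m≤m+n (size ψ) (size θ))))
  μ-step {main _ _ (ψ ∨ᶠ θ)} s-orR = inj₁ (*-monoʳ-< 2 (s≤s (m≤n+m (size θ) (size ψ))))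
  μ-step {main _ _ (⟪ A ⟫X ψ)} (s-nx₁ α) = inj₁ (suc-2*<2*suc (size ψ))
  μ-step {nx₂ _ _ _ ψ _} (s-nx₂ β) = inj₁ (n<1+n (2 * size ψ))
  μ-step {main _ _ (⟪ A ⟫ ψ U θ)} s-U = inj₁ (suc-2*<2*suc (size ψ + size θ))
  μ-step {main _ _ (⟪ A ⟫ ψ R θ)} s-R = inj₁ (suc-2*<2*suc (size ψ + size θ))
  μ-step {eC w _} s-Cend = inj₁ (exit-C-smaller w)
  μ-step {eC w _} s-Cgo = inj₂ (refl , inj₂ (w , refl , refl))
  μ-step {eCb w _} s-Cbend = inj₁ (exit-C̅-smaller w)
  μ-step {eCb w _} s-Cbgo = inj₂ (refl , inj₂ (w , refl , refl))
  μ-step {eV w _} (s-V α) = inj₂ (refl , inj₂ (w , refl , refl))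
  μ-step {eVb w _ _} (s-Vb β) = inj₂ (refl , inj₂ (w , refl , refl))

module UnboundedStrategy (lem : ∀ {ℓ} → ExcludedMiddle ℓ) (M : CGM) (X : Player) where
  open CGM M
  open Eval M
  open Classical lem
  open Moves M
  open ClassicalMoves lem M
  open UnboundedValue lem M
  open UnboundedPlays M

  module Ctrl (w : Origin) =
    Canonical (Ver w ==ᴾ X) (Origin.A w) (λ q → exit-value w q ≡ X) (λ q → exit-value̅ w q ≡ X)

  Avoiding : Origin → St → Set
  Avoiding w q = ¬ ForcesFrom w (opp X) q

  avoid-move : (w : Origin) (q : St) → ⊤ ⊎ SMove (Ver w ==ᴾ X) (Origin.A w) q
  avoid-move w q with dec (exit-value̅ w q ≡ X)
  ... | yes _ = inj₁ tt
  ... | no _ = inj₂ (force (Ver w ==ᴾ X) (Origin.A w) q (Avoiding w))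

  strategy : UStrat X
  strategy = record
    { disj = λ q ψ θ → does (dec (value X q ψ ≡ X))
    ; nxt = λ P q A ψ → force (P ==ᴾ X) A q λ q' → value P q' ψ ≡ X
    ; emb = λ w q → if Ctl w ==ᴾ X then Ctrl.move w q else avoid-move w q }

  open UnboundedFollowing M strategy

  controller-move : ∀ w {q} → Ctl w ≡ X → (a : ForcesFrom w X q) →
                    UStrat.emb strategy w q ≡ node (Ctrl.canonical w a)
  controller-move w c a rewrite ==ᴾ-true c = Ctrl.move-canonical w a

  avoider-move : ∀ w {q} → Ctl w ≡ opp X → UStrat.emb strategy w q ≡ avoid-move w q
  avoider-move w c rewrite ==ᴾ-false c = refl

  avoid-ends : ∀ w {q} {Pos : Set} {stop go p' : Pos} → Ends (avoid-move w q) stop go p' →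
               (p' ≡ stop × exit-value̅ w q ≡ X) ⊎ (p' ≡ go × exit-value̅ w q ≢ X)
  avoid-ends w {q} e with dec (exit-value̅ w q ≡ X)
  ... | yes stop = inj₁ (e , stop)
  ... | no go = inj₂ (e , go)

  avoid-continues : ∀ w {q} → exit-value̅ w q ≢ X →
                    avoid-move w q ≡ inj₂ (force (Ver w ==ᴾ X) (Origin.A w) q (Avoiding w))
  avoid-continues w {q} go with dec (exit-value̅ w q ≡ X)
  ... | yes stop = ⊥-elim (go stop)
  ... | no _ = refl

  avoidance : ∀ w {q} → Avoiding w q → exit-value̅ w q ≡ opp X →
              ForcesNext (Ver w ==ᴾ X) (Origin.A w) q (Avoiding w)
  avoidance w {q} avoiding stays =
    step-determined (Ver w ==ᴾ X) {Origin.A w} {q} {ForcesFrom w (opp X)} opponent-stuck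
    where
      opponent-stuck : ¬ ForcesNext (not (Ver w ==ᴾ X)) (Origin.A w) q (ForcesFrom w (opp X))
      opponent-stuck F rewrite sym (==ᴾ-opp (Ver w) X) = avoiding (step stays (proj₁ F) (proj₂ F))

  ByController : Origin → Set → Set → Set
  ByController w S T = (Ctl w ≡ X → S) × (Ctl w ≡ opp X → T)

  Committed : Origin → St → Set
  Committed w q = Σ (ForcesFrom w X q) λ a → IsStep (Ctrl.canonical w a)

  Favourable : UPos → Set
  Favourable (main P q ψ) = value P q ψ ≡ X
  Favourable (nx₂ P q A ψ α) = Keeps (P ==ᴾ X) A q (λ q' → value P q' ψ ≡ X) α
  Favourable (eC w q) = ByController w (ForcesFrom w X q) (Avoiding w q)
  Favourable (eCb w q) = ByController w (Committed w q) (Avoiding w q)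
  Favourable (eV w q) = ByController w (Committed w q) (Avoiding w q × exit-value̅ w q ≡ opp X)
  Favourable (eVb w q α) =
    ByController w (Σ (ForcesFrom w X q) λ a → CommitsTo (Ctrl.canonical w a) α)
                   (exit-value̅ w q ≡ opp X × Keeps (Ver w ==ᴾ X) (Origin.A w) q (Avoiding w) α)

  favourable-∨ : ∀ {P q ψ θ χ} → value P q (ψ ∨ᶠ θ) ≡ X →
                 UFollows strategy (main P q (ψ ∨ᶠ θ)) (main P q χ) → χ ≡ ψ ⊎ χ ≡ θ → value P q χ ≡ X
  favourable-∨ {P} {q} {ψ} {θ} v f which with player-cases X P
  ... | inj₁ refl = subst (λ p → Favourable p) (sym (follows-∨ f)) (value-∨-own v)
  ... | inj₂ refl with value-∨-other {X} {q} {ψ} {θ} v | which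
  ...   | left , _ | inj₁ refl = left
  ...   | _ , right | inj₂ refl = right

  entering : ∀ w → claim (Ctl w) (dec (ForcesFrom w (Ctl w) (Origin.q₀ w))) ≡ X →
             Favourable (eC w (Origin.q₀ w))
  entering w v with claim-inv (dec (ForcesFrom w (Ctl w) (Origin.q₀ w))) (Ctl w) X v
  ... | inj₁ (F , c) =
    (λ _ → subst (λ Y → ForcesFrom w Y (Origin.q₀ w)) c F) , λ c̄ → ⊥-elim (≡⇒≢opp c c̄)
  ... | inj₂ (¬F , c̄) = (λ c → ⊥-elim (opp-≢ X (trans (cong opp (sym c)) c̄))) ,
                          λ c → subst (λ Y → ¬ ForcesFrom w Y (Origin.q₀ w)) c ¬F

  favourable-Cend : ∀ {w q} → Favourable (eC w q) →
                    UFollows strategy (eC w q) (main (Ver w) q (ψC w)) → exit-value w q ≡ X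
  favourable-Cend {w} {q} (ctrl , avoid) f with player-cases X (Ctl w)
  ... | inj₂ c = ≢opp⇒≡ λ e → avoid c (exit e)
  ... | inj₁ c with node-ends (Ctrl.canonical w (ctrl c)) (follows-eC c (controller-move w c (ctrl c)) f)
  ...   | inj₁ (_ , ex) = ex
  ...   | inj₂ (() , _)

  favourable-Cgo : ∀ {w q} → Favourable (eC w q) → UFollows strategy (eC w q) (eCb w q) →
                   Favourable (eCb w q)
  favourable-Cgo {w} {q} (ctrl , avoid) f = committed , avoid
    where
      committed : Ctl w ≡ X → Committed w q
      committed c with node-ends (Ctrl.canonical w (ctrl c)) (follows-eC c (controller-move w c (ctrl c)) f)
      ... | inj₁ (() , _)
      ... | inj₂ (_ , is-step) = ctrl c , is-step

  favourable-Cbend : ∀ {w q} → Favourable (eCb w q) →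
                     UFollows strategy (eCb w q) (main (Ver w) q (ψCb w)) → exit-value̅ w q ≡ X
  favourable-Cbend {w} {q} (ctrl , avoid) f with player-cases X (Ctl w)
  ... | inj₁ c = step-stays (Ctrl.canonical w (proj₁ (ctrl c))) (proj₂ (ctrl c))
  ... | inj₂ c with avoid-ends w (follows-eCb c (avoider-move w c) f)
  ...   | inj₁ (_ , stop) = stop
  ...   | inj₂ (() , _)

  favourable-Cbgo : ∀ {w q} → Favourable (eCb w q) → UFollows strategy (eCb w q) (eV w q) →
                    Favourable (eV w q)
  favourable-Cbgo {w} {q} (ctrl , avoid) f = ctrl , λ c → avoid c , continues c
    where
      continues : Ctl w ≡ opp X → exit-value̅ w q ≡ opp X
      continues c with avoid-ends w (follows-eCb c (avoider-move w c) f)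
      ... | inj₁ (() , _)
      ... | inj₂ (_ , go) = ≢⇒≡opp go

  favourable-V : ∀ {w q α} → Favourable (eV w q) → UFollows strategy (eV w q) (eVb w q α) →
                 Favourable (eVb w q α)
  favourable-V {w} {q} (ctrl , avoid) f = commits , keeps
    where
      commits : Ctl w ≡ X → Σ (ForcesFrom w X q) λ a → CommitsTo (Ctrl.canonical w a) _
      commits c = let (a , is-step) = ctrl c in
        a , node-commits (λ { refl → refl }) (Ctrl.canonical w a) is-step
              (follows-eV (controller-move w c a) f)
      keeps : Ctl w ≡ opp X → _
      keeps c = let (avoiding , stays) = avoid c in
        stays , keeps-first (Ver w ==ᴾ X) (λ { refl → refl }) (avoidance w avoiding stays)
                  (follows-eV (trans (avoider-move w c) (avoid-continues w (≡opp⇒≢ stays))) f)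

  controller-steps : ∀ {w q α β} → Ctl w ≡ X → (a : ForcesFrom w X q) → CommitsTo (Ctrl.canonical w a) α →
                     UFollows strategy (eVb w q α) (eC w (o q (join α β))) →
                     StepsTo (Ctrl.canonical w a) (o q (join α β))
  controller-steps {w} c a commits f =
    node-reaches {next = eC w} (λ { refl → refl }) (Ctrl.canonical w a) commits
                 (follows-eVb (controller-move w c a) f)

  favourable-Vb : ∀ {w q α β} → Favourable (eVb w q α) →
                  UFollows strategy (eVb w q α) (eC w (o q (join α β))) → Favourable (eC w (o q (join α β)))
  favourable-Vb {w} {q} {α} {β} (ctrl , avoid) f = forces , avoids
    where
      forces : Ctl w ≡ X → ForcesFrom w X (o q (join α β))
      forces c = let (a , commits) = ctrl c in subtree (Ctrl.canonical w a) (controller-steps c a commits f)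
      avoids : Ctl w ≡ opp X → Avoiding w (o q (join α β))
      avoids c = let (stays , keeps) = avoid c in
        keeps-second (Ver w ==ᴾ X) {next = eC w} (λ { refl → refl }) keeps
          (follows-eVb (trans (avoider-move w c) (avoid-continues w (≡opp⇒≢ stays))) f)

  favourable-step : ∀ {p p'} → Favourable p → UStep p p' → UFollows strategy p p' → Favourable p'
  favourable-step g s-atom f = g
  favourable-step g s-neg f = g
  favourable-step g s-orL f = favourable-∨ g f (inj₁ refl)
  favourable-step g s-orR f = favourable-∨ g f (inj₂ refl)
  favourable-step {main P q (⟪ A ⟫X ψ)} g (s-nx₁ α) f =
    keeps-first (P ==ᴾ X) (λ { refl → refl }) (value-next {X} {P} {q} {A} {ψ} g) (follows-nx₁ f)
  favourable-step {nx₂ P q A ψ α} g (s-nx₂ β) f =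
    keeps-second (P ==ᴾ X) {next = λ q' → main P q' ψ} (λ { refl → refl }) g (follows-nx₂ f)
  favourable-step {main P q (⟪ A ⟫ ψ U θ)} g s-U f = entering (orig P q 𝐔 A ψ θ) g
  favourable-step {main P q (⟪ A ⟫ ψ R θ)} g s-R f = entering (orig P q 𝐑 A ψ θ) g
  favourable-step {eC w q} g s-Cend f = favourable-Cend {w} {q} g f
  favourable-step {eC w q} g s-Cgo f = favourable-Cgo {w} {q} g f
  favourable-step {eCb w q} g s-Cbend f = favourable-Cbend {w} {q} g f
  favourable-step {eCb w q} g s-Cbgo f = favourable-Cbgo {w} {q} g f
  favourable-step {eV w q} g (s-V α) f = favourable-V {w} {q} g f
  favourable-step {eVb w q α} g (s-Vb β) f = favourable-Vb {w} {q} {α} g f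

  favourable-along : ∀ {s} → IsPlay s → (∀ n → UFollows strategy (s n) (s (suc n))) →
                     Favourable (s 0) → ∀ n → Favourable (s n)
  favourable-along play follows g zero = g
  favourable-along play follows g (suc n) =
    favourable-step (favourable-along play follows g n) (play n) (follows n)

  terminal-won : ∀ {p} → Terminal p → Favourable p → uwinner p ≡ just X
  terminal-won t g with terminal-atom t
  ... | _ , _ , _ , refl = cong just g

  witness : ∀ {w} p → embedded-game p ≡ just w → Ctl w ≡ X → Favourable p → ForcesFrom w X (state p)
  witness (eC _ _) refl c g = proj₁ g c
  witness (eCb _ _) refl c g = proj₁ (proj₁ g c)
  witness (eV _ _) refl c g = proj₁ (proj₁ g c)
  witness (eVb _ _ _) refl c g = proj₁ (proj₁ g c)

  rank-at : ∀ {w} p → embedded-game p ≡ just w → Ctl w ≡ X → Favourable p → Ord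
  rank-at {w} p e c g = Ctrl.rank w (Ctrl.canonical w (witness p e c g))

  phase : UPos → ℕ
  phase (eC _ _) = 3
  phase (eCb _ _) = 2
  phase (eV _ _) = 1
  phase _ = 0

  rank-descends : ∀ {w p p'} (e : embedded-game p ≡ just w) (e' : embedded-game p' ≡ just w) (c : Ctl w ≡ X)
                  (g : Favourable p) (g' : Favourable p') → UStep p p' → UFollows strategy p p' →
                  rank-at p' e' c g' ≺ rank-at p e c g ⊎
                  (rank-at p' e' c g' ≡ rank-at p e c g × phase p' < phase p)
  rank-descends {w} refl refl c g g' s-Cgo f = inj₂ (Ctrl.same-rank w _ _ , ≤-refl)
  rank-descends {w} refl refl c g g' s-Cbgo f = inj₂ (Ctrl.same-rank w _ _ , ≤-refl)
  rank-descends {w} refl refl c g g' (s-V α) f = inj₂ (Ctrl.same-rank w _ _ , ≤-refl)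
  rank-descends {w} refl refl c g g' (s-Vb β) f =
    let (a , commits) = proj₁ g c in
    inj₁ (Ctrl.rank-below w (Ctrl.canonical w a) (controller-steps c a commits f) (proj₁ g' c))
  rank-descends refl () c g g' s-Cend f
  rank-descends refl () c g g' s-Cbend f
  rank-descends () e' c g g' s-atom f
  rank-descends () e' c g g' s-neg f
  rank-descends () e' c g g' s-orL f
  rank-descends () e' c g g' s-orR f
  rank-descends () e' c g g' (s-nx₁ _) f
  rank-descends () e' c g g' (s-nx₂ _) f
  rank-descends () e' c g g' s-U f
  rank-descends () e' c g g' s-R f

  open Confinement lem embedded-game μ μ-step

  strategy-wins : ∀ {s} → IsPlay s → (∀ n → UFollows strategy (s n) (s (suc n))) →
                  Favourable (s 0) → Won X s
  strategy-wins {s} play follows g₀ with dec (∃[ n ] Terminal (s n))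
  ... | yes (n , t) = inj₁ (n , terminal-won t (favourable-along play follows g₀ n))
  ... | no never with eventually-in-one-game play (λ n t → never (n , t))
  ...   | N , w , inside with player-cases X (Ctl w)
  ...     | inj₂ c = inj₂ (N , λ m N≤m →
              trans (game-controlled (subst (λ m → embedded-game (s m) ≡ just w) (m+[n∸m]≡n N≤m)
                                            (inside (m ∸ N))))
                    (cong just c))
  ...     | inj₁ c = ⊥-elim (no-lex-descent ≺-wellFounded
              (λ k → rank-at (s (N + k)) (inside k) c (favourable (N + k))) (λ k → phase (s (N + k)))
              λ k → rank-descends (inside k) (inside (suc k)) c (favourable (N + k)) (favourable (N + suc k))
                                  (suffix {UStep} {s} play N k)
                                  (suffix {UFollows strategy} {s} follows N k))
    where
      favourable = favourable-along play follows g₀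

  value-winner-wins : ∀ q φ → value 𝐄 q φ ≡ X → UWins X q φ
  value-winner-wins q φ v = strategy , λ s s₀ along →
    strategy-wins (λ n → proj₁ (along n)) (λ n → proj₂ (along n)) (subst Favourable (sym s₀) v)

module UnboundedExclusive (M : CGM) where
  open Eval M
  open Moves M
  open UnboundedPlays M

  module Joint (σE : UStrat 𝐄) (σA : UStrat 𝐀) where
    open UStrat

    Agreeing : UPos → UPos → Set
    Agreeing p p' = UStep p p' × UFollows σE p p' × UFollows σA p p'

    joint-step : ∀ p → Σ UPos (Agreeing p)
    joint-step (main P q (atom a)) = _ , s-atom , tt , tt
    joint-step (main P q (¬ᶠ ψ)) = _ , s-neg , tt , tt
    joint-step (main 𝐄 q (ψ ∨ᶠ θ)) with disj σE q ψ θ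
    ... | true = _ , s-orL , refl , tt
    ... | false = _ , s-orR , refl , tt
    joint-step (main 𝐀 q (ψ ∨ᶠ θ)) with disj σA q ψ θ
    ... | true = _ , s-orL , tt , refl
    ... | false = _ , s-orR , tt , refl
    joint-step (main 𝐄 q (⟪ A ⟫X ψ)) = _ , s-nx₁ (nxt σE 𝐄 q A ψ) , refl , tt
    joint-step (main 𝐀 q (⟪ A ⟫X ψ)) = _ , s-nx₁ (nxt σA 𝐀 q A ψ) , tt , refl
    joint-step (main P q (⟪ A ⟫ ψ U θ)) = _ , s-U , tt , tt
    joint-step (main P q (⟪ A ⟫ ψ R θ)) = _ , s-R , tt , tt
    joint-step (nx₂ 𝐄 q A ψ α) = _ , s-nx₂ (nxt σA 𝐄 q A ψ α) , tt , refl
    joint-step (nx₂ 𝐀 q A ψ α) = _ , s-nx₂ (nxt σE 𝐀 q A ψ α) , refl , tt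
    joint-step (eC w q) with Ctl w
    ... | 𝐄 with emb σE w q
    ...   | inj₁ _ = _ , s-Cend , refl , tt
    ...   | inj₂ _ = _ , s-Cgo , refl , tt
    joint-step (eC w q) | 𝐀 with emb σA w q
    ...   | inj₁ _ = _ , s-Cend , tt , refl
    ...   | inj₂ _ = _ , s-Cgo , tt , refl
    joint-step (eCb w q) with Ctl w
    ... | 𝐀 with emb σE w q
    ...   | inj₁ _ = _ , s-Cbend , refl , tt
    ...   | inj₂ _ = _ , s-Cbgo , refl , tt
    joint-step (eCb w q) | 𝐄 with emb σA w q
    ...   | inj₁ _ = _ , s-Cbend , tt , refl
    ...   | inj₂ _ = _ , s-Cbgo , tt , refl
    joint-step (eV w@(orig 𝐄 _ _ A _ _) q) with emb σE w q
    ... | inj₁ _ = _ , s-V (default-tuple A q) , tt , tt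
    ... | inj₂ α = _ , s-V α , refl , tt
    joint-step (eV w@(orig 𝐀 _ _ A _ _) q) with emb σA w q
    ... | inj₁ _ = _ , s-V (default-tuple A q) , tt , tt
    ... | inj₂ α = _ , s-V α , tt , refl
    joint-step (eVb w@(orig 𝐄 _ _ A _ _) q α) with emb σA w q
    ... | inj₁ _ = _ , s-Vb (default-tuple (co A) q) , tt , tt
    ... | inj₂ f = _ , s-Vb (f α) , tt , refl
    joint-step (eVb w@(orig 𝐀 _ _ A _ _) q α) with emb σE w q
    ... | inj₁ _ = _ , s-Vb (default-tuple (co A) q) , tt , tt
    ... | inj₂ f = _ , s-Vb (f α) , refl , tt

    joint-play : UPos → ℕ → UPos
    joint-play p₀ zero = p₀
    joint-play p₀ (suc n) = proj₁ (joint-step (joint-play p₀ n))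

    joint-agreeing : ∀ p₀ n → Agreeing (joint-play p₀ n) (joint-play p₀ (suc n))
    joint-agreeing p₀ n = proj₂ (joint-step (joint-play p₀ n))

  not-both-win : ∀ X q φ → UWins X q φ → UWins (opp X) q φ → ⊥
  not-both-win 𝐄 q φ (σE , E-wins) (σA , A-wins) =
    won-exclusive 𝐄 (λ n → proj₁ (agreeing n))
      (E-wins play refl λ n → let (st , fE , _) = agreeing n in st , fE)
      (A-wins play refl λ n → let (st , _ , fA) = agreeing n in st , fA)
    where
      open Joint σE σA
      play = joint-play (main 𝐄 q φ)
      agreeing = joint-agreeing (main 𝐄 q φ)
  not-both-win 𝐀 q φ A-wins E-wins = not-both-win 𝐄 q φ E-wins A-wins

module BoundedFollowing (M : CGM) (Γ : WellOrder) {X : Player} (σ : Eval.Bounded.BStrat M Γ X) where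
  open CGM M
  open Eval M
  open Bounded Γ
  open WellOrder Γ using (O)
  open Moves M
  open BStrat σ

  move-at : (w : Origin) (γ₀ γ : O) (q : St) → ⊤ ⊎ SMove (Ver w ==ᴾ X) (Origin.A w) q
  move-at w = embMove w (Ctl w ==ᴾ X) (emb w)

  as-controller : ∀ w → Ctl w ≡ X → CtrlS X w
  as-controller w c = if-holds (==ᴾ-true c) (emb w)

  follows-∨ : ∀ {q ψ θ p'} → BFollows σ (main X q (ψ ∨ᶠ θ)) p' →
              p' ≡ main X q (if disj q ψ θ then ψ else θ)
  follows-∨ = if-holds (==ᴾ-true {X} refl)

  follows-nx₁ : ∀ {P q A ψ p'} → BFollows σ (main P q (⟪ A ⟫X ψ)) p' →
                PlaysTuple (P ==ᴾ X) (inj₂ (nxt P q A ψ)) (nx₂ P q A ψ) p'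
  follows-nx₁ {P} {q} {A} {ψ} f with P ==ᴾ X | nxt P q A ψ
  ... | true | _ = f
  ... | false | _ = tt

  follows-nx₂ : ∀ {P q A ψ α p'} → BFollows σ (nx₂ P q A ψ α) p' →
                Responds (P ==ᴾ X) (inj₂ (nxt P q A ψ)) α (λ β → main P (o q (join α β)) ψ) p'
  follows-nx₂ {P} {q} {A} {ψ} f with P ==ᴾ X | nxt P q A ψ
  ... | true | _ = tt
  ... | false | _ = f

  follows-start : ∀ {w p'} (c : Ctl w ≡ X) → BFollows σ (bStart w) p' →
                  p' ≡ bCfg w (CtrlS.γ₀ (as-controller w c)) (CtrlS.γ₀ (as-controller w c)) (Origin.q₀ w)
  follows-start {w} c f with Ctl w ==ᴾ X | emb w | ==ᴾ-true c
  ... | true | _ | refl = f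

  follows-lim : ∀ {w γ₀ γ q p'} (c : Ctl w ≡ X) → BFollows σ (bLim w γ₀ γ q) p' →
                p' ≡ bCfg w γ₀ (CtrlS.timer (as-controller w c) γ q) q
  follows-lim {w} c f with Ctl w ==ᴾ X | emb w | ==ᴾ-true c
  ... | true | _ | refl = f

  follows-C : ∀ {w γ₀ γ q m p'} → Ctl w ≡ X → move-at w γ₀ γ q ≡ m → BFollows σ (bC w γ₀ γ q) p' →
              Ends m (main (Ver w) q (ψC w)) (bCb w γ₀ γ q) p'
  follows-C {w} {γ₀} {γ} {q} c refl f with Ctl w ==ᴾ X | emb w | ==ᴾ-true c
  ... | true | e | refl with embMove w true e γ₀ γ q
  ...   | inj₁ _ = f
  ...   | inj₂ _ = f

  follows-Cb : ∀ {w γ₀ γ q m p'} → Ctl w ≡ opp X → move-at w γ₀ γ q ≡ m → BFollows σ (bCb w γ₀ γ q) p' →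
               Ends m (main (Ver w) q (ψCb w)) (bV w γ₀ γ q) p'
  follows-Cb {w} {γ₀} {γ} {q} c refl f
    with opp (Ctl w) ==ᴾ X | ==ᴾ-true (trans (cong opp c) (opp-involutive X))
  ... | true | refl with move-at w γ₀ γ q
  ...   | inj₁ _ = f
  ...   | inj₂ _ = f

  follows-V : ∀ {w γ₀ γ q m p'} → move-at w γ₀ γ q ≡ m → BFollows σ (bV w γ₀ γ q) p' →
              PlaysTuple (Ver w ==ᴾ X) m (bVb w γ₀ γ q) p'
  follows-V {w} {γ₀} {γ} {q} refl f with Ver w ==ᴾ X | move-at w γ₀ γ q
  ... | true | inj₁ _ = tt
  ... | true | inj₂ _ = f
  ... | false | _ = tt

  follows-Vb : ∀ {w γ₀ γ q m α p'} → move-at w γ₀ γ q ≡ m → BFollows σ (bVb w γ₀ γ q α) p' →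
               Responds (Ver w ==ᴾ X) m α (λ β → bNext w γ₀ γ (o q (join α β))) p'
  follows-Vb {w} {γ₀} {γ} {q} refl f with Ver w ==ᴾ X | move-at w γ₀ γ q
  ... | false | inj₁ _ = tt
  ... | false | inj₂ _ = f
  ... | true | _ = tt

module BoundedMoves (M : CGM) (Γ : WellOrder) where
  open CGM M
  open Eval M
  open WellOrder Γ renaming (_<_ to _<ₒ_; trans to <ₒ-trans)
  open Moves M
    using (Response; outcome; Reaches; Commits; commits-first; commits-second; Ends; PlaysTuple; Responds)

  <ₒ-irreflexive : ∀ {γ} → ¬ γ <ₒ γ
  <ₒ-irreflexive {γ} = go (wf γ)
    where
      go : ∀ {γ} → Acc _<ₒ_ γ → ¬ γ <ₒ γ
      go (acc rs) γ<γ = go (rs γ<γ) γ<γ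

  successor-unique : ∀ {γ δ δ'} → IsSuccOf γ δ → IsSuccOf γ δ' → δ' ≡ δ
  successor-unique (δ<γ , below-δ) (δ'<γ , below-δ') with below-δ _ δ'<γ | below-δ' _ δ<γ
  ... | inj₂ δ'≡δ | _ = δ'≡δ
  ... | inj₁ _ | inj₂ δ≡δ' = sym δ≡δ'
  ... | inj₁ δ'<δ | inj₁ δ<δ' = ⊥-elim (<ₒ-irreflexive (<ₒ-trans δ'<δ δ<δ'))

  mutual
    data BAttractor (b : Bool) (A : Coalition) (Exit Stay : St → Set) : O → St → Set where
      exit : ∀ {γ q} → Exit q → BAttractor b A Exit Stay γ q
      step : ∀ {γ q} → ¬ IsZero γ → Stay q → (m : SMove b A q) →
             (∀ r → Later b A Exit Stay γ (outcome b A q m r)) → BAttractor b A Exit Stay γ q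

    data Later (b : Bool) (A : Coalition) (Exit Stay : St → Set) : O → St → Set where
      succ : ∀ {γ δ q} → IsSuccOf γ δ → BAttractor b A Exit Stay δ q → Later b A Exit Stay γ q
      limit : ∀ {γ γ' q} → IsLimit γ → γ' <ₒ γ → BAttractor b A Exit Stay γ' q → Later b A Exit Stay γ q

  module _ {b : Bool} {A : Coalition} {Exit Stay : St → Set} where
    private
      Att = BAttractor b A Exit Stay

    node : ∀ {γ q} → Att γ q → ⊤ ⊎ SMove b A q
    node (exit _) = inj₁ tt
    node (step _ _ m _) = inj₂ m

    IsStep : ∀ {γ q} → Att γ q → Set
    IsStep (exit _) = ⊥
    IsStep (step _ _ _ _) = ⊤

    step-stays : ∀ {γ q} (t : Att γ q) → IsStep t → Stay q
    step-stays (step _ stay _ _) _ = stay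

    zero-exits : ∀ {γ q} → IsZero γ → Att γ q → Exit q
    zero-exits _ (exit ex) = ex
    zero-exits γ≡0 (step γ≢0 _ _ _) = ⊥-elim (γ≢0 γ≡0)

    node-ends : ∀ {Pos : Set} {γ q} (t : Att γ q) {stop go p' : Pos} →
                Ends (node t) stop go p' → (p' ≡ stop × Exit q) ⊎ (p' ≡ go × IsStep t)
    node-ends (exit ex) e = inj₁ (e , ex)
    node-ends (step _ _ _ _) e = inj₂ (e , tt)

    StepsTo : ∀ {γ q} → Att γ q → St → Set
    StepsTo (exit _) q' = ⊥
    StepsTo (step _ _ m _) q' = Reaches b m q'

    later : ∀ {γ q q'} (t : Att γ q) → StepsTo t q' → Later b A Exit Stay γ q'
    later (step _ _ _ k) (r , refl) = k r

    CommitsTo : ∀ {γ q} → Att γ q → Tup A q → Set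
    CommitsTo (exit _) α = ⊥
    CommitsTo (step _ _ m _) α = Commits b m α

    node-commits : ∀ {γ q} {Pos : Set} {next : Tup A q → Pos} → Injective _≡_ _≡_ next →
                   (t : Att γ q) → IsStep t → ∀ {α} → PlaysTuple b (node t) next (next α) → CommitsTo t α
    node-commits next-injective (step _ _ _ _) _ = commits-first b next-injective

    node-reaches : ∀ {γ q} {Pos : Set} {next : St → Pos} → Injective _≡_ _≡_ next →
                   (t : Att γ q) → ∀ {α β} → CommitsTo t α →
                   Responds b (node t) α (λ β → next (o q (join α β))) (next (o q (join α β))) →
                   StepsTo t (o q (join α β))
    node-reaches next-injective (step _ _ _ _) = commits-second b next-injective

module BoundedValue (lem : ∀ {ℓ} → ExcludedMiddle ℓ) (M : CGM) (Γ : WellOrder) where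
  open CGM M
  open Eval M
  open WellOrder Γ using (O)
  open ClassicalMoves lem M
  open BoundedMoves M Γ

  ControllerForces : Origin → (St → Player) → (St → Player) → Set
  ControllerForces w e e̅ = Σ O λ γ →
    BAttractor (Ver w ==ᴾ Ctl w) (Origin.A w) (λ q → e q ≡ Ctl w) (λ q → e̅ q ≡ Ctl w) γ (Origin.q₀ w)

  open Value ControllerForces public

  ForcesAt LaterFor : Origin → Player → O → St → Set
  ForcesAt w Y = BAttractor (Ver w ==ᴾ Y) (Origin.A w) (λ q → exit-value w q ≡ Y) (λ q → exit-value̅ w q ≡ Y)
  LaterFor w Y = Later (Ver w ==ᴾ Y) (Origin.A w) (λ q → exit-value w q ≡ Y) (λ q → exit-value̅ w q ≡ Y)

module BoundedPlays (M : CGM) (Γ : WellOrder) where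
  open Eval M
  open Bounded Γ
  open WellOrder Γ using (O; wf; IsZero) renaming (_<_ to _<ₒ_)
  open Moves M

  embedded-game : BPos → Maybe Origin
  embedded-game (main _ _ _) = nothing
  embedded-game (nx₂ _ _ _ _ _) = nothing
  embedded-game (bStart w) = just w
  embedded-game (bCfg w _ _ _) = just w
  embedded-game (bC w _ _ _) = just w
  embedded-game (bCb w _ _ _) = just w
  embedded-game (bV w _ _ _) = just w
  embedded-game (bVb w _ _ _ _) = just w
  embedded-game (bNext w _ _ _) = just w
  embedded-game (bLim w _ _ _) = just w

  open PlayProperties M BStep bwinner bctrl public

  terminal-atom : ∀ {p} → Terminal p → ∃[ P ] ∃[ q ] ∃[ a ] p ≡ main P q (atom a)
  terminal-atom {main P q (atom a)} _ = P , q , a , refl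
  terminal-atom {main _ _ (¬ᶠ _)} (_ , ())
  terminal-atom {main _ _ (_ ∨ᶠ _)} (_ , ())
  terminal-atom {main _ _ (⟪ _ ⟫X _)} (_ , ())
  terminal-atom {main _ _ (⟪ _ ⟫ _ U _)} (_ , ())
  terminal-atom {main _ _ (⟪ _ ⟫ _ R _)} (_ , ())
  terminal-atom {nx₂ _ _ _ _ _} (_ , ())
  terminal-atom {bStart _} (_ , ())
  terminal-atom {bCfg _ _ _ _} (_ , ())
  terminal-atom {bC _ _ _ _} (_ , ())
  terminal-atom {bCb _ _ _ _} (_ , ())
  terminal-atom {bV _ _ _ _} (_ , ())
  terminal-atom {bVb _ _ _ _ _} (_ , ())
  terminal-atom {bNext _ _ _ _} (_ , ())
  terminal-atom {bLim _ _ _ _} (_ , ())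

  terminal-absorbing : ∀ {p p'} → Terminal p → BStep p p' → p' ≡ p
  terminal-absorbing t st with terminal-atom t
  ... | _ , _ , _ , refl with st
  ...   | s-atom = refl

  terminal-uncontrolled : ∀ {p} → Terminal p → bctrl p ≡ nothing
  terminal-uncontrolled t with terminal-atom t
  ... | _ , _ , _ , refl = refl

  open Exclusive terminal-absorbing terminal-uncontrolled public

  μ : BPos → ℕ
  μ (main _ _ ψ) = 2 * size ψ
  μ (nx₂ _ _ _ ψ _) = suc (2 * size ψ)
  μ (bStart w) = game-size w
  μ (bCfg w _ _ _) = game-size w
  μ (bC w _ _ _) = game-size w
  μ (bCb w _ _ _) = game-size w
  μ (bV w _ _ _) = game-size w
  μ (bVb w _ _ _ _) = game-size w
  μ (bNext w _ _ _) = game-size w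
  μ (bLim w _ _ _) = game-size w

  SameGame : BPos → BPos → Set
  SameGame p p' = ∃[ w ] embedded-game p ≡ just w × embedded-game p' ≡ just w

  μ-step : ∀ {p p'} → BStep p p' → μ p' < μ p ⊎ (μ p' ≡ μ p × (Terminal p ⊎ SameGame p p'))
  μ-step s-atom = inj₂ (refl , inj₁ (_ , refl))
  μ-step {main _ _ (¬ᶠ ψ)} s-neg = inj₁ (*-monoʳ-< 2 (n<1+n (size ψ)))
  μ-step {main _ _ (ψ ∨ᶠ θ)} s-orL = inj₁ (*-monoʳ-< 2 (s≤s (m≤m+n (size ψ) (size θ))))
  μ-step {main _ _ (ψ ∨ᶠ θ)} s-orR = inj₁ (*-monoʳ-< 2 (s≤s (m≤n+m (size θ) (size ψ))))
  μ-step {main _ _ (⟪ A ⟫X ψ)} (s-nx₁ α) = inj₁ (suc-2*<2*suc (size ψ))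
  μ-step {nx₂ _ _ _ ψ _} (s-nx₂ β) = inj₁ (n<1+n (2 * size ψ))
  μ-step {main _ _ (⟪ A ⟫ ψ U θ)} s-U = inj₁ (suc-2*<2*suc (size ψ + size θ))
  μ-step {main _ _ (⟪ A ⟫ ψ R θ)} s-R = inj₁ (suc-2*<2*suc (size ψ + size θ))
  μ-step {bStart w} (s-start _) = inj₂ (refl , inj₂ (w , refl , refl))
  μ-step {bCfg w _ _ _} (s-zero _) = inj₁ (exit-C-smaller w)
  μ-step {bCfg w _ _ _} (s-nzero _) = inj₂ (refl , inj₂ (w , refl , refl))
  μ-step {bC w _ _ _} s-Cend = inj₁ (exit-C-smaller w)
  μ-step {bC w _ _ _} s-Cgo = inj₂ (refl , inj₂ (w , refl , refl))
  μ-step {bCb w _ _ _} s-Cbend = inj₁ (exit-C̅-smaller w)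
  μ-step {bCb w _ _ _} s-Cbgo = inj₂ (refl , inj₂ (w , refl , refl))
  μ-step {bV w _ _ _} (s-V _) = inj₂ (refl , inj₂ (w , refl , refl))
  μ-step {bVb w _ _ _ _} (s-Vb _) = inj₂ (refl , inj₂ (w , refl , refl))
  μ-step {bNext w _ _ _} (s-succ _) = inj₂ (refl , inj₂ (w , refl , refl))
  μ-step {bNext w _ _ _} (s-lim _) = inj₂ (refl , inj₂ (w , refl , refl))
  μ-step {bLim w _ _ _} (s-limpick _ _) = inj₂ (refl , inj₂ (w , refl , refl))

  IsStart : BPos → Set
  IsStart (bStart _) = ⊤
  IsStart _ = ⊥

  step-not-start : ∀ {p p' w} → BStep p p' → embedded-game p ≡ just w → ¬ IsStart p'
  step-not-start (s-start _) _ ()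
  step-not-start (s-nzero _) _ ()
  step-not-start s-Cgo _ ()
  step-not-start s-Cbgo _ ()
  step-not-start (s-V _) _ ()
  step-not-start (s-Vb _) _ ()
  step-not-start (s-succ _) _ ()
  step-not-start (s-lim _) _ ()
  step-not-start (s-limpick _ _) _ ()
  step-not-start (s-zero _) _ ()
  step-not-start s-Cend _ ()
  step-not-start s-Cbend _ ()

  clock : BPos → O → O
  clock (bCfg _ _ γ _) _ = γ
  clock (bC _ _ γ _) _ = γ
  clock (bCb _ _ γ _) _ = γ
  clock (bV _ _ γ _) _ = γ
  clock (bVb _ _ γ _ _) _ = γ
  clock (bNext _ _ γ _) _ = γ
  clock (bLim _ _ γ _) _ = γ
  clock _ default = default

  phase : BPos → ℕ
  phase (bCfg _ _ _ _) = 6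
  phase (bC _ _ _ _) = 5
  phase (bCb _ _ _ _) = 4
  phase (bV _ _ _ _) = 3
  phase (bVb _ _ _ _ _) = 2
  phase (bNext _ _ _ _) = 1
  phase _ = 0

  clock-descends : ∀ {p p' w} default → BStep p p' → embedded-game p ≡ just w → embedded-game p' ≡ just w →
                   ¬ IsStart p → clock p' default <ₒ clock p default ⊎
                                 (clock p' default ≡ clock p default × phase p' < phase p)
  clock-descends _ (s-start _) _ _ not-start = ⊥-elim (not-start tt)
  clock-descends _ (s-nzero _) _ _ _ = inj₂ (refl , ≤-refl)
  clock-descends _ s-Cgo _ _ _ = inj₂ (refl , ≤-refl)
  clock-descends _ s-Cbgo _ _ _ = inj₂ (refl , ≤-refl)
  clock-descends _ (s-V _) _ _ _ = inj₂ (refl , ≤-refl)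
  clock-descends _ (s-Vb _) _ _ _ = inj₂ (refl , ≤-refl)
  clock-descends _ (s-succ δ+1≡γ) _ _ _ = inj₁ (proj₁ δ+1≡γ)
  clock-descends _ (s-lim _) _ _ _ = inj₂ (refl , ≤-refl)
  clock-descends _ (s-limpick _ γ'<γ) _ _ _ = inj₁ γ'<γ
  clock-descends _ s-atom () _ _
  clock-descends _ s-neg () _ _
  clock-descends _ s-orL () _ _
  clock-descends _ s-orR () _ _
  clock-descends _ (s-nx₁ _) () _ _
  clock-descends _ (s-nx₂ _) () _ _
  clock-descends _ s-U () _ _
  clock-descends _ s-R () _ _
  clock-descends _ (s-zero _) _ () _
  clock-descends _ s-Cend _ () _
  clock-descends _ s-Cbend _ () _

  embedded-game-ends : O → ∀ {s} → IsPlay s → ∀ N w → ¬ (∀ k → embedded-game (s (N + k)) ≡ just w)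
  embedded-game-ends default {s} play N w inside =
    no-lex-descent wf (λ k → clock (s (suc (N + k))) default) (λ k → phase (s (suc (N + k)))) λ k →
      clock-descends default (shifted k) (inside′ k) (inside′ (suc k))
                     (step-not-start (play (N + k)) (inside k))
    where
      shifted : ∀ k → BStep (s (suc (N + k))) (s (suc (N + suc k)))
      shifted k = suffix {BStep} {λ n → s (suc n)} (λ n → play (suc n)) N k
      inside′ : ∀ k → embedded-game (s (suc (N + k))) ≡ just w
      inside′ k = subst (λ m → embedded-game (s m) ≡ just w) (+-suc N k) (inside (suc k))

module BoundedStrategy (lem : ∀ {ℓ} → ExcludedMiddle ℓ) (M : CGM) (Γ : WellOrder) (o₀ : WellOrder.O Γ)
                       (X : Player) where
  open CGM M
  open Eval M
  open Bounded Γ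
  open WellOrder Γ using (O; IsZero; IsSuccOf; IsLimit) renaming (_<_ to _<ₒ_)
  open Classical lem
  open Moves M hiding (node; IsStep; step-stays; node-ends; StepsTo; CommitsTo; node-commits; node-reaches)
  open ClassicalMoves lem M
  open BoundedMoves M Γ
  open BoundedValue lem M Γ
  open BoundedPlays M Γ

  module Ctrl (w : Origin) where
    Forcing : O → St → Set
    Forcing = ForcesAt w X

    chosen : ∀ {γ q} → Forcing γ q → Forcing γ q
    chosen {γ} {q} a with dec (Forcing γ q)
    ... | yes t = t
    ... | no ¬t = ⊥-elim (¬t a)

    move : (γ : O) (q : St) → ⊤ ⊎ SMove (Ver w ==ᴾ X) (Origin.A w) q
    move γ q with dec (Forcing γ q)
    ... | yes t = node t
    ... | no _ = inj₁ tt

    move-chosen : ∀ {γ q} (a : Forcing γ q) → move γ q ≡ node (chosen a)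
    move-chosen {γ} {q} a with dec (Forcing γ q)
    ... | yes t = refl
    ... | no ¬t = ⊥-elim (¬t a)

    timer : O → St → O
    timer γ q = choose (λ γ' → γ' <ₒ γ × Forcing γ' q) (choose (_<ₒ γ) γ)

    timer< : ∀ γ q → IsLimit γ → timer γ q <ₒ γ
    timer< γ q (γ≢0 , _) with choose-cases (λ γ' → γ' <ₒ γ × Forcing γ' q) (choose (_<ₒ γ) γ)
    ... | inj₁ (γ'<γ , _) = γ'<γ
    ... | inj₂ e rewrite e =
      choose-spec (_<ₒ γ) γ (dne λ nothing-below → γ≢0 λ δ δ<γ → nothing-below (δ , δ<γ))

    timer-forcing : ∀ {γ q} → Σ O (λ γ' → γ' <ₒ γ × Forcing γ' q) → Forcing (timer γ q) q
    timer-forcing {γ} {q} F = proj₂ (choose-spec (λ γ' → γ' <ₒ γ × Forcing γ' q) _ F)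

    start : O
    start = choose (λ γ → Forcing γ (Origin.q₀ w)) o₀

    strategy : CtrlS X w
    strategy = record { γ₀ = start ; timer = timer ; timer< = timer< ; mv = move }

  Avoiding : Origin → O → St → Set
  Avoiding w γ q = ¬ LaterFor w (opp X) γ q

  avoid-move : (w : Origin) (γ : O) (q : St) → ⊤ ⊎ SMove (Ver w ==ᴾ X) (Origin.A w) q
  avoid-move w γ q with dec (exit-value̅ w q ≡ X)
  ... | yes _ = inj₁ tt
  ... | no _ = inj₂ (force (Ver w ==ᴾ X) (Origin.A w) q (Avoiding w γ))

  avoid-ends : ∀ w {γ q} {Pos : Set} {stop go p' : Pos} → Ends (avoid-move w γ q) stop go p' →
               (p' ≡ stop × exit-value̅ w q ≡ X) ⊎ (p' ≡ go × exit-value̅ w q ≢ X)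
  avoid-ends w {γ} {q} e with dec (exit-value̅ w q ≡ X)
  ... | yes stop = inj₁ (e , stop)
  ... | no go = inj₂ (e , go)

  avoid-continues : ∀ w {γ q} → exit-value̅ w q ≢ X →
                    avoid-move w γ q ≡ inj₂ (force (Ver w ==ᴾ X) (Origin.A w) q (Avoiding w γ))
  avoid-continues w {γ} {q} go with dec (exit-value̅ w q ≡ X)
  ... | yes stop = ⊥-elim (go stop)
  ... | no _ = refl

  avoidance : ∀ w {γ q} → ¬ IsZero γ → ¬ ForcesAt w (opp X) γ q → exit-value̅ w q ≡ opp X →
              ForcesNext (Ver w ==ᴾ X) (Origin.A w) q (Avoiding w γ)
  avoidance w {γ} {q} γ≢0 ¬forces stays =
    step-determined (Ver w ==ᴾ X) {Origin.A w} {q} {LaterFor w (opp X) γ} opponent-stuck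
    where
      opponent-stuck : ¬ ForcesNext (not (Ver w ==ᴾ X)) (Origin.A w) q (LaterFor w (opp X) γ)
      opponent-stuck F rewrite sym (==ᴾ-opp (Ver w) X) = ¬forces (step γ≢0 stays (proj₁ F) (proj₂ F))

  embedded : (b : Bool) (w : Origin) → if b then CtrlS X w else NonCtrlS X w
  embedded true w = Ctrl.strategy w
  embedded false w _ = avoid-move w

  strategy : BStrat X
  strategy = record
    { disj = λ q ψ θ → does (dec (value X q ψ ≡ X))
    ; nxt = λ P q A ψ → force (P ==ᴾ X) A q λ q' → value P q' ψ ≡ X
    ; emb = λ w → embedded (Ctl w ==ᴾ X) w }

  open BoundedFollowing M Γ strategy

  controller-strategy : ∀ w (c : Ctl w ≡ X) → as-controller w c ≡ Ctrl.strategy w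
  controller-strategy w c with Ctl w ==ᴾ X | ==ᴾ-true c
  ... | true | refl = refl

  controller-move : ∀ w {γ₀ γ q} → Ctl w ≡ X → (a : ForcesAt w X γ q) →
                    move-at w γ₀ γ q ≡ node (Ctrl.chosen w a)
  controller-move w c a rewrite ==ᴾ-true c = Ctrl.move-chosen w a

  avoider-move : ∀ w {γ₀ γ q} → Ctl w ≡ opp X → move-at w γ₀ γ q ≡ avoid-move w γ q
  avoider-move w c rewrite ==ᴾ-false c = refl

  ByController : Origin → Set → Set → Set
  ByController w S T = (Ctl w ≡ X → S) × (Ctl w ≡ opp X → T)

  Committed : Origin → O → St → Set
  Committed w γ q = Σ (ForcesAt w X γ q) λ a → IsStep (Ctrl.chosen w a)

  Favourable : BPos → Set
  Favourable (main P q ψ) = value P q ψ ≡ X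
  Favourable (nx₂ P q A ψ α) = Keeps (P ==ᴾ X) A q (λ q' → value P q' ψ ≡ X) α
  Favourable (bStart w) =
    ByController w (Σ O λ γ → ForcesAt w X γ (Origin.q₀ w)) (∀ γ → ¬ ForcesAt w (opp X) γ (Origin.q₀ w))
  Favourable (bCfg w _ γ q) = ByController w (ForcesAt w X γ q) (¬ ForcesAt w (opp X) γ q)
  Favourable (bC w _ γ q) = ¬ IsZero γ × ByController w (ForcesAt w X γ q) (¬ ForcesAt w (opp X) γ q)
  Favourable (bCb w _ γ q) = ¬ IsZero γ × ByController w (Committed w γ q) (¬ ForcesAt w (opp X) γ q)
  Favourable (bV w _ γ q) =
    ¬ IsZero γ × ByController w (Committed w γ q) (¬ ForcesAt w (opp X) γ q × exit-value̅ w q ≡ opp X)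
  Favourable (bVb w _ γ q α) =
    ByController w (Σ (ForcesAt w X γ q) λ a → CommitsTo (Ctrl.chosen w a) α)
                   (exit-value̅ w q ≡ opp X × Keeps (Ver w ==ᴾ X) (Origin.A w) q (Avoiding w γ) α)
  Favourable (bNext w _ γ q) = ByController w (LaterFor w X γ q) (Avoiding w γ q)
  Favourable (bLim w _ γ q) =
    ByController w (Σ O λ γ' → γ' <ₒ γ × ForcesAt w X γ' q) (∀ γ' → γ' <ₒ γ → ¬ ForcesAt w (opp X) γ' q)

  favourable-∨ : ∀ {P q ψ θ χ} → value P q (ψ ∨ᶠ θ) ≡ X →
                 BFollows strategy (main P q (ψ ∨ᶠ θ)) (main P q χ) → χ ≡ ψ ⊎ χ ≡ θ → value P q χ ≡ X
  favourable-∨ {P} {q} {ψ} {θ} v f which with player-cases X P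
  ... | inj₁ refl = subst (λ p → Favourable p) (sym (follows-∨ f)) (value-∨-own v)
  ... | inj₂ refl with value-∨-other {X} {q} {ψ} {θ} v | which
  ...   | left , _ | inj₁ refl = left
  ...   | _ , right | inj₂ refl = right

  entering : ∀ w → claim (Ctl w) (dec (Σ O λ γ → ForcesAt w (Ctl w) γ (Origin.q₀ w))) ≡ X →
             Favourable (bStart w)
  entering w v with claim-inv (dec (Σ O λ γ → ForcesAt w (Ctl w) γ (Origin.q₀ w))) (Ctl w) X v
  ... | inj₁ ((γ , F) , c) =
    (λ _ → γ , subst (λ Y → ForcesAt w Y γ (Origin.q₀ w)) c F) , λ c̄ → ⊥-elim (≡⇒≢opp c c̄)
  ... | inj₂ (¬F , c̄) =
    (λ c → ⊥-elim (opp-≢ X (trans (cong opp (sym c)) c̄))) ,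
    λ c γ F → ¬F (γ , subst (λ Y → ForcesAt w Y γ (Origin.q₀ w)) (sym c) F)

  favourable-start : ∀ {w γ₀} → Favourable (bStart w) →
                     BFollows strategy (bStart w) (bCfg w γ₀ γ₀ (Origin.q₀ w)) →
                     Favourable (bCfg w γ₀ γ₀ (Origin.q₀ w))
  favourable-start {w} {γ₀} (ctrl , avoid) f = forces , λ c → avoid c γ₀
    where
      forces : Ctl w ≡ X → ForcesAt w X γ₀ (Origin.q₀ w)
      forces c with trans (follows-start c f) (cong (λ σ → bCfg w (CtrlS.γ₀ σ) (CtrlS.γ₀ σ) (Origin.q₀ w))
                                                     (controller-strategy w c))
      ... | refl = choose-spec (λ γ → ForcesAt w X γ (Origin.q₀ w)) o₀ (ctrl c)

  favourable-zero : ∀ {w γ₀ γ q} → IsZero γ → Favourable (bCfg w γ₀ γ q) → exit-value w q ≡ X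
  favourable-zero {w} γ≡0 (ctrl , avoid) with player-cases X (Ctl w)
  ... | inj₁ c = zero-exits γ≡0 (ctrl c)
  ... | inj₂ c = ≢opp⇒≡ λ e → avoid c (exit e)

  favourable-Cend : ∀ {w γ₀ γ q} → Favourable (bC w γ₀ γ q) →
                    BFollows strategy (bC w γ₀ γ q) (main (Ver w) q (ψC w)) → exit-value w q ≡ X
  favourable-Cend {w} {γ₀} {γ} {q} (_ , ctrl , avoid) f with player-cases X (Ctl w)
  ... | inj₂ c = ≢opp⇒≡ λ e → avoid c (exit e)
  ... | inj₁ c
    with node-ends (Ctrl.chosen w (ctrl c)) (follows-C {w} {γ₀} {γ} {q} c (controller-move w c (ctrl c)) f)
  ...   | inj₁ (_ , ex) = ex
  ...   | inj₂ (() , _)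

  favourable-Cgo : ∀ {w γ₀ γ q} → Favourable (bC w γ₀ γ q) →
                   BFollows strategy (bC w γ₀ γ q) (bCb w γ₀ γ q) → Favourable (bCb w γ₀ γ q)
  favourable-Cgo {w} {γ₀} {γ} {q} (γ≢0 , ctrl , avoid) f = γ≢0 , committed , avoid
    where
      committed : Ctl w ≡ X → Committed w γ q
      committed c
        with node-ends (Ctrl.chosen w (ctrl c)) (follows-C {w} {γ₀} {γ} {q} c (controller-move w c (ctrl c)) f)
      ... | inj₁ (() , _)
      ... | inj₂ (_ , is-step) = ctrl c , is-step

  favourable-Cbend : ∀ {w γ₀ γ q} → Favourable (bCb w γ₀ γ q) →
                     BFollows strategy (bCb w γ₀ γ q) (main (Ver w) q (ψCb w)) → exit-value̅ w q ≡ X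
  favourable-Cbend {w} {γ₀} {γ} {q} (_ , ctrl , avoid) f with player-cases X (Ctl w)
  ... | inj₁ c = step-stays (Ctrl.chosen w (proj₁ (ctrl c))) (proj₂ (ctrl c))
  ... | inj₂ c with avoid-ends w (follows-Cb {w} {γ₀} {γ} {q} c (avoider-move w {γ₀} c) f)
  ...   | inj₁ (_ , stop) = stop
  ...   | inj₂ (() , _)

  favourable-Cbgo : ∀ {w γ₀ γ q} → Favourable (bCb w γ₀ γ q) →
                    BFollows strategy (bCb w γ₀ γ q) (bV w γ₀ γ q) → Favourable (bV w γ₀ γ q)
  favourable-Cbgo {w} {γ₀} {γ} {q} (γ≢0 , ctrl , avoid) f = γ≢0 , ctrl , λ c → avoid c , continues c
    where
      continues : Ctl w ≡ opp X → exit-value̅ w q ≡ opp X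
      continues c with avoid-ends w (follows-Cb {w} {γ₀} {γ} {q} c (avoider-move w {γ₀} c) f)
      ... | inj₁ (() , _)
      ... | inj₂ (_ , go) = ≢⇒≡opp go

  favourable-V : ∀ {w γ₀ γ q α} → Favourable (bV w γ₀ γ q) →
                 BFollows strategy (bV w γ₀ γ q) (bVb w γ₀ γ q α) → Favourable (bVb w γ₀ γ q α)
  favourable-V {w} {γ₀} {γ} {q} (γ≢0 , ctrl , avoid) f = commits , keeps
    where
      commits : Ctl w ≡ X → Σ (ForcesAt w X γ q) λ a → CommitsTo (Ctrl.chosen w a) _
      commits c = let (a , is-step) = ctrl c in
        a , node-commits (λ { refl → refl }) (Ctrl.chosen w a) is-step
              (follows-V {w} {γ₀} {γ} {q} (controller-move w c a) f)
      keeps : Ctl w ≡ opp X → _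
      keeps c = let (¬forces , stays) = avoid c in
        stays , keeps-first (Ver w ==ᴾ X) (λ { refl → refl }) (avoidance w γ≢0 ¬forces stays)
                  (follows-V {w} {γ₀} {γ} {q} (trans (avoider-move w c) (avoid-continues w (≡opp⇒≢ stays))) f)

  favourable-Vb : ∀ {w γ₀ γ q α β} → Favourable (bVb w γ₀ γ q α) →
                  BFollows strategy (bVb w γ₀ γ q α) (bNext w γ₀ γ (o q (join α β))) →
                  Favourable (bNext w γ₀ γ (o q (join α β)))
  favourable-Vb {w} {γ₀} {γ} {q} {α} {β} (ctrl , avoid) f = forces , avoids
    where
      forces : Ctl w ≡ X → LaterFor w X γ (o q (join α β))
      forces c = let (a , commits) = ctrl c in
        later (Ctrl.chosen w a)
          (node-reaches {next = bNext w γ₀ γ} (λ { refl → refl }) (Ctrl.chosen w a) commits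
                        (follows-Vb {w} {γ₀} {γ} {q} (controller-move w {γ₀} c a) f))
      avoids : Ctl w ≡ opp X → Avoiding w γ (o q (join α β))
      avoids c = let (stays , keeps) = avoid c in
        keeps-second (Ver w ==ᴾ X) {next = bNext w γ₀ γ} (λ { refl → refl }) keeps
          (follows-Vb {w} {γ₀} {γ} {q} (trans (avoider-move w c) (avoid-continues w (≡opp⇒≢ stays))) f)

  favourable-succ : ∀ {w γ₀ γ q δ} → IsSuccOf γ δ → Favourable (bNext w γ₀ γ q) → Favourable (bCfg w γ₀ δ q)
  favourable-succ {w} {γ₀} {γ} {q} {δ} δ+1≡γ (ctrl , avoid) =
    forces ∘ ctrl , λ c F → avoid c (succ δ+1≡γ F)
    where
      forces : LaterFor w X γ q → ForcesAt w X δ q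
      forces (succ δ'+1≡γ F) = subst (λ δ → ForcesAt w X δ q) (successor-unique δ+1≡γ δ'+1≡γ) F
      forces (limit (_ , not-successor) _ _) = ⊥-elim (not-successor δ δ+1≡γ)

  favourable-lim : ∀ {w γ₀ γ q} → IsLimit γ → Favourable (bNext w γ₀ γ q) → Favourable (bLim w γ₀ γ q)
  favourable-lim {w} {γ₀} {γ} {q} lim (ctrl , avoid) =
    forces ∘ ctrl , λ c γ' γ'<γ F → avoid c (limit lim γ'<γ F)
    where
      forces : LaterFor w X γ q → Σ O λ γ' → γ' <ₒ γ × ForcesAt w X γ' q
      forces (succ δ+1≡γ _) = ⊥-elim (proj₂ lim _ δ+1≡γ)
      forces (limit _ γ'<γ F) = _ , γ'<γ , F

  favourable-limpick : ∀ {w γ₀ γ q γ'} → γ' <ₒ γ → Favourable (bLim w γ₀ γ q) →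
                       BFollows strategy (bLim w γ₀ γ q) (bCfg w γ₀ γ' q) → Favourable (bCfg w γ₀ γ' q)
  favourable-limpick {w} {γ₀} {γ} {q} {γ'} γ'<γ (ctrl , avoid) f = forces , λ c → avoid c γ' γ'<γ
    where
      forces : Ctl w ≡ X → ForcesAt w X γ' q
      forces c
        with trans (follows-lim c f) (cong (λ σ → bCfg w γ₀ (CtrlS.timer σ γ q) q) (controller-strategy w c))
      ... | refl = Ctrl.timer-forcing w (ctrl c)

  favourable-step : ∀ {p p'} → Favourable p → BStep p p' → BFollows strategy p p' → Favourable p'
  favourable-step g s-atom f = g
  favourable-step g s-neg f = g
  favourable-step g s-orL f = favourable-∨ g f (inj₁ refl)
  favourable-step g s-orR f = favourable-∨ g f (inj₂ refl)
  favourable-step {main P q (⟪ A ⟫X ψ)} g (s-nx₁ α) f =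
    keeps-first (P ==ᴾ X) (λ { refl → refl }) (value-next {X} {P} {q} {A} {ψ} g) (follows-nx₁ f)
  favourable-step {nx₂ P q A ψ α} g (s-nx₂ β) f =
    keeps-second (P ==ᴾ X) {next = λ q' → main P q' ψ} (λ { refl → refl }) g (follows-nx₂ f)
  favourable-step {main P q (⟪ A ⟫ ψ U θ)} g s-U f = entering (orig P q 𝐔 A ψ θ) g
  favourable-step {main P q (⟪ A ⟫ ψ R θ)} g s-R f = entering (orig P q 𝐑 A ψ θ) g
  favourable-step {bStart w} g (s-start γ₀) f = favourable-start {w} {γ₀} g f
  favourable-step {bCfg w γ₀ γ q} g (s-zero γ≡0) f = favourable-zero {w} {γ₀} {γ} {q} γ≡0 g
  favourable-step g (s-nzero γ≢0) f = γ≢0 , g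
  favourable-step {bC w γ₀ γ q} g s-Cend f = favourable-Cend {w} {γ₀} {γ} {q} g f
  favourable-step {bC w γ₀ γ q} g s-Cgo f = favourable-Cgo {w} {γ₀} {γ} {q} g f
  favourable-step {bCb w γ₀ γ q} g s-Cbend f = favourable-Cbend {w} {γ₀} {γ} {q} g f
  favourable-step {bCb w γ₀ γ q} g s-Cbgo f = favourable-Cbgo {w} {γ₀} {γ} {q} g f
  favourable-step {bV w γ₀ γ q} g (s-V α) f = favourable-V {w} {γ₀} {γ} {q} g f
  favourable-step {bVb w γ₀ γ q α} g (s-Vb β) f = favourable-Vb {w} {γ₀} {γ} {q} {α} g f
  favourable-step {bNext w γ₀ γ q} g (s-succ δ+1≡γ) f = favourable-succ {w} {γ₀} {γ} {q} δ+1≡γ g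
  favourable-step {bNext w γ₀ γ q} g (s-lim lim) f = favourable-lim {w} {γ₀} {γ} {q} lim g
  favourable-step {bLim w γ₀ γ q} g (s-limpick γ' γ'<γ) f =
    favourable-limpick {w} {γ₀} {γ} {q} γ'<γ g f

  favourable-along : ∀ {s} → IsPlay s → (∀ n → BFollows strategy (s n) (s (suc n))) →
                     Favourable (s 0) → ∀ n → Favourable (s n)
  favourable-along play follows g zero = g
  favourable-along play follows g (suc n) =
    favourable-step (favourable-along play follows g n) (play n) (follows n)

  terminal-won : ∀ {p} → Terminal p → Favourable p → bwinner p ≡ just X
  terminal-won t g with terminal-atom t
  ... | _ , _ , _ , refl = cong just g

  open Confinement lem embedded-game μ μ-step

  strategy-wins : ∀ {s} → IsPlay s → (∀ n → BFollows strategy (s n) (s (suc n))) →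
                  Favourable (s 0) → Won X s
  strategy-wins {s} play follows g₀ with dec (∃[ n ] Terminal (s n))
  ... | yes (n , t) = inj₁ (n , terminal-won t (favourable-along play follows g₀ n))
  ... | no never with eventually-in-one-game play (λ n t → never (n , t))
  ...   | N , w , inside = ⊥-elim (embedded-game-ends o₀ play N w inside)

  value-winner-wins : ∀ q φ → value 𝐄 q φ ≡ X → BWins X q φ
  value-winner-wins q φ v = strategy , λ s s₀ along →
    strategy-wins (λ n → proj₁ (along n)) (λ n → proj₂ (along n)) (subst Favourable (sym s₀) v)

module BoundedExclusive (lem : ∀ {ℓ} → ExcludedMiddle ℓ) (M : CGM) (Γ : WellOrder) where
  open Eval M
  open Bounded Γ
  open WellOrder Γ using (O; IsZero; IsSuccOf; IsLimit)
  open Classical lem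
  open Moves M
  open BoundedPlays M Γ

  -- after rule (i), resp. at a limit move, the time limit is known to be nonzero, resp. a limit
  Sane : BPos → Set
  Sane (bC _ _ γ _) = ¬ IsZero γ
  Sane (bCb _ _ γ _) = ¬ IsZero γ
  Sane (bV _ _ γ _) = ¬ IsZero γ
  Sane (bVb _ _ γ _ _) = ¬ IsZero γ
  Sane (bNext _ _ γ _) = ¬ IsZero γ
  Sane (bLim _ _ γ _) = IsLimit γ
  Sane _ = ⊤

  module Joint (σE : BStrat 𝐄) (σA : BStrat 𝐀) where
    open BStrat

    Agreeing : BPos → BPos → Set
    Agreeing p p' = BStep p p' × BFollows σE p p' × BFollows σA p p' × Sane p'

    joint-step : ∀ p → Sane p → Σ BPos (Agreeing p)
    joint-step (main P q (atom a)) _ = _ , s-atom , tt , tt , tt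
    joint-step (main P q (¬ᶠ ψ)) _ = _ , s-neg , tt , tt , tt
    joint-step (main 𝐄 q (ψ ∨ᶠ θ)) _ with disj σE q ψ θ
    ... | true = _ , s-orL , refl , tt , tt
    ... | false = _ , s-orR , refl , tt , tt
    joint-step (main 𝐀 q (ψ ∨ᶠ θ)) _ with disj σA q ψ θ
    ... | true = _ , s-orL , tt , refl , tt
    ... | false = _ , s-orR , tt , refl , tt
    joint-step (main 𝐄 q (⟪ A ⟫X ψ)) _ = _ , s-nx₁ (nxt σE 𝐄 q A ψ) , refl , tt , tt
    joint-step (main 𝐀 q (⟪ A ⟫X ψ)) _ = _ , s-nx₁ (nxt σA 𝐀 q A ψ) , tt , refl , tt
    joint-step (main P q (⟪ A ⟫ ψ U θ)) _ = _ , s-U , tt , tt , tt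
    joint-step (main P q (⟪ A ⟫ ψ R θ)) _ = _ , s-R , tt , tt , tt
    joint-step (nx₂ 𝐄 q A ψ α) _ = _ , s-nx₂ (nxt σA 𝐄 q A ψ α) , tt , refl , tt
    joint-step (nx₂ 𝐀 q A ψ α) _ = _ , s-nx₂ (nxt σE 𝐀 q A ψ α) , refl , tt , tt
    joint-step (bStart w) _ with Ctl w | emb σE w | emb σA w
    ... | 𝐄 | ctrl | _ = _ , s-start (CtrlS.γ₀ ctrl) , refl , tt , tt
    ... | 𝐀 | _ | ctrl = _ , s-start (CtrlS.γ₀ ctrl) , tt , refl , tt
    joint-step (bCfg w γ₀ γ q) _ with dec (IsZero γ)
    ... | yes γ≡0 = _ , s-zero γ≡0 , tt , tt , tt
    ... | no γ≢0 = _ , s-nzero γ≢0 , tt , tt , γ≢0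
    joint-step (bC w γ₀ γ q) γ≢0 with Ctl w | emb σE w | emb σA w
    ... | 𝐄 | ctrl | _ with CtrlS.mv ctrl γ q
    ...   | inj₁ _ = _ , s-Cend , refl , tt , tt
    ...   | inj₂ _ = _ , s-Cgo , refl , tt , γ≢0
    joint-step (bC w γ₀ γ q) γ≢0 | 𝐀 | _ | ctrl with CtrlS.mv ctrl γ q
    ...   | inj₁ _ = _ , s-Cend , tt , refl , tt
    ...   | inj₂ _ = _ , s-Cgo , tt , refl , γ≢0
    joint-step (bCb w γ₀ γ q) γ≢0 with Ctl w | emb σE w | emb σA w
    ... | 𝐀 | other | _ with other γ₀ γ q
    ...   | inj₁ _ = _ , s-Cbend , refl , tt , tt
    ...   | inj₂ _ = _ , s-Cbgo , refl , tt , γ≢0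
    joint-step (bCb w γ₀ γ q) γ≢0 | 𝐄 | _ | other with other γ₀ γ q
    ...   | inj₁ _ = _ , s-Cbend , tt , refl , tt
    ...   | inj₂ _ = _ , s-Cbgo , tt , refl , γ≢0
    joint-step (bV w@(orig 𝐄 _ _ A _ _) γ₀ γ q) γ≢0 with embMove w (Ctl w ==ᴾ 𝐄) (emb σE w) γ₀ γ q
    ... | inj₁ _ = _ , s-V (default-tuple A q) , tt , tt , γ≢0
    ... | inj₂ α = _ , s-V α , refl , tt , γ≢0
    joint-step (bV w@(orig 𝐀 _ _ A _ _) γ₀ γ q) γ≢0 with embMove w (Ctl w ==ᴾ 𝐀) (emb σA w) γ₀ γ q
    ... | inj₁ _ = _ , s-V (default-tuple A q) , tt , tt , γ≢0
    ... | inj₂ α = _ , s-V α , tt , refl , γ≢0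
    joint-step (bVb w@(orig 𝐄 _ _ A _ _) γ₀ γ q α) γ≢0 with embMove w (Ctl w ==ᴾ 𝐀) (emb σA w) γ₀ γ q
    ... | inj₁ _ = _ , s-Vb (default-tuple (co A) q) , tt , tt , γ≢0
    ... | inj₂ f = _ , s-Vb (f α) , tt , refl , γ≢0
    joint-step (bVb w@(orig 𝐀 _ _ A _ _) γ₀ γ q α) γ≢0 with embMove w (Ctl w ==ᴾ 𝐄) (emb σE w) γ₀ γ q
    ... | inj₁ _ = _ , s-Vb (default-tuple (co A) q) , tt , tt , γ≢0
    ... | inj₂ f = _ , s-Vb (f α) , refl , tt , γ≢0
    joint-step (bNext w γ₀ γ q) γ≢0 with dec (Σ O (IsSuccOf γ))
    ... | yes (δ , δ+1≡γ) = _ , s-succ δ+1≡γ , tt , tt , tt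
    ... | no not-successor = _ , s-lim lim , tt , tt , lim
      where lim = γ≢0 , λ δ δ+1≡γ → not-successor (δ , δ+1≡γ)
    joint-step (bLim w γ₀ γ q) lim with Ctl w | emb σE w | emb σA w
    ... | 𝐄 | ctrl | _ = _ , s-limpick _ (CtrlS.timer< ctrl γ q lim) , refl , tt , tt
    ... | 𝐀 | _ | ctrl = _ , s-limpick _ (CtrlS.timer< ctrl γ q lim) , tt , refl , tt

    joint-play : ∀ p₀ → Sane p₀ → ℕ → Σ BPos Sane
    joint-play p₀ sane zero = p₀ , sane
    joint-play p₀ sane (suc n) =
      let (p , sane-p) = joint-play p₀ sane n
          (p' , _ , _ , _ , sane-p') = joint-step p sane-p
      in p' , sane-p'

    joint-agreeing : ∀ p₀ sane n →
                     Agreeing (proj₁ (joint-play p₀ sane n)) (proj₁ (joint-play p₀ sane (suc n)))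
    joint-agreeing p₀ sane n = proj₂ (joint-step _ (proj₂ (joint-play p₀ sane n)))

  not-both-win : ∀ X q φ → BWins X q φ → BWins (opp X) q φ → ⊥
  not-both-win 𝐄 q φ (σE , E-wins) (σA , A-wins) =
    won-exclusive 𝐄 (λ n → proj₁ (agreeing n))
      (E-wins play refl λ n → let (st , fE , _) = agreeing n in st , fE)
      (A-wins play refl λ n → let (st , _ , fA , _) = agreeing n in st , fA)
    where
      open Joint σE σA
      play = λ n → proj₁ (joint-play (main 𝐄 q φ) tt n)
      agreeing = joint-agreeing (main 𝐄 q φ) tt
  not-both-win 𝐀 q φ A-wins E-wins = not-both-win 𝐄 q φ E-wins A-wins

proposition4p28 : (∀ {ℓ} → ExcludedMiddle ℓ) →
    (M : CGM) (q : CGM.St M) (φ : Eval.Fm M) (Γ : WellOrder) →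
    WellOrder.O Γ → (P : Player) →
    (Eval.UWins M P q φ ⇔ (¬ Eval.UWins M (opp P) q φ))
    × (Eval.Bounded.BWins M Γ P q φ ⇔ (¬ Eval.Bounded.BWins M Γ (opp P) q φ))
proposition4p28 lem M q φ Γ o₀ P =
  determined-by (UnboundedValue.value lem M 𝐄 q φ)
    (λ X → UnboundedStrategy.value-winner-wins lem M X q φ)
    (λ X → UnboundedExclusive.not-both-win M X q φ) P ,
  determined-by (BoundedValue.value lem M Γ 𝐄 q φ)
    (λ X → BoundedStrategy.value-winner-wins lem M Γ o₀ X q φ)
    (λ X → BoundedExclusive.not-both-win lem M Γ X q φ) P
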